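{- For every $n\ge1$, the linear map $\Psi:C(\mathcal{NCP}(n),\mid)\to C(\mathcal{NCP}(n),\circ)$ defined on basis elements by $\Psi([\alpha,\beta])=K_\beta(\alpha)$ is a morphism of coalgebras.
   Context: A partition of $[m]=\{1,\dots,m\}$ is noncrossing if there are no two distinct blocks $B,C$ and $a<b<c<d$ with $a,c\in B$, $b,d\in C$. $\mathcal{NCP}(m)$ denotes the lattice of noncrossing partitions of $[m]$ under refinement ($\pi\mid\mu$ iff each block of $\pi$ is contained in a block of $\mu$), with join $\vee$; $0_n$ is the partition into singletons. Vector spaces are over $\mathbb{Q}$. For $\alpha,\beta\in\mathcal{NCP}(n)$, $\alpha\ast_n\beta$ is the partition of $[2n]$ with blocks $\{2x-1:x\in B\}$ ($B$ a block of $\alpha$) and $\{2x:x\in C\}$ ($C$ a block of $\beta$); $(\alpha,\beta)$ is admissible if $\alpha\ast_n\beta$ is noncrossing, and then $\alpha\circ\beta:=\sqrt{(\alpha\ast_n\beta)\vee\{\{1,2\},\dots,\{2n-1,2n\}\}}$ (join in $\mathcal{NCP}(2n)$), where for $\gamma\in\mathcal{NCP}(2n)$ in which $2i-1,2i$ are always in the same block, $\sqrt\gamma$ has blocks $\{i:2i\in D\}$, $D$ a block of $\gamma$. For $\alpha\mid\beta$ in $\mathcal{NCP}(n)$, the relative Kreweras complement $K_\beta(\alpha)$ is the unique $\gamma\in\mathcal{NCP}(n)$ such that $(\alpha,\gamma)$ is admissible and $\alpha\circ\gamma=\beta$. $C(\mathcal{NCP}(n),\mid)$ is the incidence coalgebra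 of the poset: it has basis the intervals $[\alpha,\beta]$ with $\alpha\mid\beta$, comultiplication $\Delta([\alpha,\beta])=\sum_{\alpha\mid\gamma\mid\beta}[\alpha,\gamma]\otimes[\gamma,\beta]$ and counit $[\alpha,\beta]\mapsto 1$ if $\alpha=\beta$, $0$ otherwise. $C(\mathcal{NCP}(n),\circ)$ has basis $\mathcal{NCP}(n)$, comultiplication $\Delta_\circ(\pi)=\sum\alpha\otimes\beta$ over admissible pairs $(\alpha,\beta)$ with $\alpha\circ\beta=\pi$, and counit $\pi\mapsto1$ if $\pi=0_n$, $0$ otherwise. -}

module Defs where

open import Data.Bool using (Bool; true; false; _∧_; _∨_; not; if_then_else_)
open import Data.Nat using (ℕ; zero; suc; _+_; _*_; _≡ᵇ_; _<ᵇ_; ⌊_/2⌋; _%_)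
open import Data.List using (List; []; _∷_; _++_; [_]; map; concatMap; upTo; filterᵇ; findᵇ; length)
open import Data.Maybe using (Maybe; just; nothing)

-- Points of [m] are represented 0-based by the naturals 0,…,m-1
-- (the paper's point k corresponds to k-1 here).
-- A (set) partition of [m] is represented by its "same block" relation
--   R : ℕ → ℕ → Bool,  R i j = true  iff  i and j lie in the same block,
-- only the values for i , j < m being relevant.

Part : Set
Part = ℕ → ℕ → Bool

allL : {A : Set} → (A → Bool) → List A → Bool
allL p []       = true
allL p (x ∷ xs) = p x ∧ allL p xs

allBelow : ℕ → (ℕ → Bool) → Bool
allBelow m P = allL P (upTo m)

eqPart : ℕ → Part → Part → Bool
eqPart m R S = allBelow m λ i → allBelow m λ j → eqB (R i j) (S i j)
  where
  eqB : Bool → Bool → Bool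
  eqB true  b = b
  eqB false b = not b

refines : ℕ → Part → Part → Bool
refines m R S = allBelow m λ i → allBelow m λ j → not (R i j) ∨ S i j

nonCrossing : ℕ → Part → Bool
nonCrossing m R =
  allBelow m λ a → allBelow m λ b → allBelow m λ c → allBelow m λ d →
    not ((a <ᵇ b) ∧ (b <ᵇ c) ∧ (c <ᵇ d) ∧ R a c ∧ R b d ∧ not (R a b))

-- Enumeration of all set partitions of [m], each exactly once:
-- a partition is encoded canonically by the list l of length m with
-- l[i] = least element of the block of i  (so l[i] ≤ i and l[l[i]] = l[i]).

lookupD : List ℕ → ℕ → ℕ
lookupD []       _       = 0
lookupD (x ∷ _)  zero    = x
lookupD (_ ∷ xs) (suc i) = lookupD xs i

labelLists : ℕ → List (List ℕ)
labelLists zero    = [] ∷ []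
labelLists (suc k) = concatMap (λ l → map (λ x → l ++ [ x ]) (upTo (suc k))) (labelLists k)

isCanonical : ℕ → List ℕ → Bool
isCanonical m l = allBelow m λ i → lookupD l (lookupD l i) ≡ᵇ lookupD l i

toPart : List ℕ → Part
toPart l i j = lookupD l i ≡ᵇ lookupD l j

NCP : ℕ → List Part
NCP m = map toPart (filterᵇ (λ l → isCanonical m l ∧ nonCrossing m (toPart l)) (labelLists m))

zeroP : Part
zeroP i j = i ≡ᵇ j

-- Join in the lattice NCP(m): the least upper bound of R and S among
-- noncrossing partitions (found by search; it always exists since the
-- one-block partition is an upper bound; the fallback is never used).

upperBound : ℕ → Part → Part → Part → Bool
upperBound m R S ν = refines m R ν ∧ refines m S ν

joinNC : ℕ → Part → Part → Part
joinNC m R S with findᵇ (λ μ → upperBound m R S μ ∧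
                              allL (λ ν → not (upperBound m R S ν) ∨ refines m μ ν) (NCP m))
                        (NCP m)
... | just μ  = μ
... | nothing = zeroP

-- α ∗ₙ β on [2n]: paper's odd points 2x-1 (0-based: 2(x-1)) carry α,
-- even points 2x (0-based: 2(x-1)+1) carry β.

isEven : ℕ → Bool
isEven i = (i % 2) ≡ᵇ 0

star : Part → Part → Part
star α β i j =
  if isEven i ∧ isEven j then α ⌊ i /2⌋ ⌊ j /2⌋
  else if not (isEven i) ∧ not (isEven j) then β ⌊ i /2⌋ ⌊ j /2⌋
  else false

pairsP : Part
pairsP i j = ⌊ i /2⌋ ≡ᵇ ⌊ j /2⌋

-- √γ : blocks {i : 2i ∈ D}; 0-based point x ↦ 0-based point 2x+1
sqrtP : Part → Part
sqrtP γ i j = γ (2 * i + 1) (2 * j + 1)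

admissible : ℕ → Part → Part → Bool
admissible n α β = nonCrossing (2 * n) (star α β)

circ : ℕ → Part → Part → Part
circ n α β = sqrtP (joinNC (2 * n) (star α β) pairsP)

-- relative Kreweras complement K_β(α): the (unique) γ ∈ NCP(n) with
-- (α,γ) admissible and α ∘ γ = β  (found by search; fallback 0ₙ).
kreweras : ℕ → Part → Part → Part
kreweras n α β with findᵇ (λ γ → admissible n α γ ∧ eqPart n (circ n α γ) β) (NCP n)
... | just γ  = γ
... | nothing = zeroP

count : {A : Set} → (A → Bool) → List A → ℕ
count p xs = length (filterᵇ p xs)

-- Coefficients (in the basis of pure tensors) of the two sides of the
-- coalgebra-morphism identity  (Ψ ⊗ Ψ) ∘ Δ = Δ∘ ∘ Ψ  on a basis element [α,β]:

-- coefficient of a ⊗ b in (Ψ⊗Ψ)(Δ[α,β]) = Σ_{α∣γ∣β} K_γ(α) ⊗ K_β(γ)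
coeffLeft : ℕ → Part → Part → Part → Part → ℕ
coeffLeft n α β a b =
  count (λ γ → refines n α γ ∧ refines n γ β ∧
               eqPart n (kreweras n α γ) a ∧ eqPart n (kreweras n γ β) b) (NCP n)

-- coefficient of a ⊗ b in Δ∘(Ψ[α,β]) = Δ∘(K_β(α))
coeffRight : ℕ → Part → Part → Part → Part → ℕ
coeffRight n α β a b =
  if admissible n a b ∧ eqPart n (circ n a b) (kreweras n α β) then 1 else 0

-- counit of C(NCP(n),∘) composed with Ψ, and counit of C(NCP(n),∣)
counitCirc : ℕ → Part → Bool
counitCirc n π = eqPart n π zeroP

counitInc : ℕ → Part → Part → Bool
counitInc n α β = eqPart n α β

{-# OPTIONS --safe #-}
-- For an admissible pair, α ∘ γ is
-- the join α ∨ γ in the lattice of all partitions (merging the blocks of two adjacent points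
-- keeps a partition noncrossing), and admissibility says that α and γ are noncrossing and
-- compatible: the points of α between two points of a block of γ form a union of blocks of α.
-- For α ≤ β the relative complement K_β(α) therefore is the unique noncrossing γ compatible
-- with α and with α ∨ γ = β, and it has an explicit description (see explicitKreweras).
-- By uniqueness and associativity of ∨, a factorization α ≤ γ ≤ β with K_γ(α) = a and
-- K_β(γ) = b forces a ∘ b = K_β(α), and when a ∘ b = K_β(α) the only such γ is α ∨ a.
-- The counit is preserved since the singleton partition is the complement of α in [α, α].
module Submission where

open import Defs
open import Algebra.Bundles using (CommutativeRing)
open import Data.Bool using (Bool; true; false; _∧_; _∨_; not; T; _xor_; if_then_else_)
open import Data.Bool.Properties using (T?; T-≡; T-not-≡; T-∧; T-∨; _≟_; xor-comm; xor-same; xor-∧-commutativeRing)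
open import Data.Empty using (⊥-elim)
open import Data.List using (List; []; _∷_; _++_; [_]; map; filter; findᵇ; upTo; length)
open import Data.List.Properties using (length-++; ∷ʳ-injective; filter-accept; filter-reject; filter-none)
open import Data.List.Membership.Propositional using (_∈_; find)
open import Data.List.Membership.Propositional.Properties
  using (∈-map⁺; ∈-map⁻; ∈-upTo⁺; ∈-upTo⁻; ∈-concatMap⁻; ∈-concatMap⁺; ∈-filter⁺; ∈-filter⁻;
         ∈-map∘filter⁻)
open import Data.List.Relation.Binary.Disjoint.Propositional using (Disjoint)
open import Data.List.Relation.Unary.Any using (here; there)
import Data.List.Relation.Unary.Any as Any
import Data.List.Relation.Unary.All as All
import Data.List.Relation.Unary.All.Properties as All
open import Data.List.Relation.Unary.AllPairs using (_∷_)
import Data.List.Relation.Unary.AllPairs as AllPairs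
import Data.List.Relation.Unary.AllPairs.Properties as AllPairs
open import Data.List.Relation.Unary.Unique.Propositional using (Unique)
import Data.List.Relation.Unary.Unique.Propositional.Properties as Unique
open import Data.Maybe using (just)
open import Data.Nat using (ℕ; zero; suc; _+_; _*_; _<_; _≤_; _<ᵇ_; _≡ᵇ_; ⌊_/2⌋; _%_; s≤s; z<s)
open import Data.Nat.DivMod using (m*n%n≡0; [m+kn]%n≡m%n)
open import Data.Nat.Induction using (<-rec)
open import Data.Nat.Properties hiding (_≟_)
open import Data.Product using (∃; _×_; _,_; proj₁; proj₂)
open import Data.Sum using (_⊎_; inj₁; inj₂; [_,_]′)
open import Function using (_∘_; _∘′_; case_of_)
open import Function.Bundles using (Equivalence)
open import Relation.Binary using (Tri; tri<; tri≈; tri>)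
open import Relation.Binary.PropositionalEquality using (_≡_; _≢_; refl; sym; trans; cong; cong₂; subst; subst₂)
open import Relation.Nullary using (¬_; contradiction; yes; no)
open import Relation.Nullary.Decidable using (toWitness; fromWitness)
open import Algebra.Properties.CommutativeSemigroup
  (CommutativeRing.+-commutativeSemigroup xor-∧-commutativeRing) using (interchange)

T-ext : ∀ {x y} → (T x → T y) → (T y → T x) → x ≡ y
T-ext {false} {false} f g = refl
T-ext {false} {true}  f g = ⊥-elim (g _)
T-ext {true}  {false} f g = ⊥-elim (f _)
T-ext {true}  {true}  f g = refl

T-not∨⁻ : ∀ {x y} → T (not x ∨ y) → T x → T y
T-not∨⁻ {true} h _ = h

T-not∨⁺ : ∀ {x y} → (T x → T y) → T (not x ∨ y)
T-not∨⁺ {false} f = _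
T-not∨⁺ {true}  f = f _

T-not∧⁻ : ∀ {x y} → T (not (x ∧ y)) → T x → T (not y)
T-not∧⁻ {true} h _ = h

T-not∧⁺ : ∀ {x y} → (T x → T (not y)) → T (not (x ∧ y))
T-not∧⁺ {false} f = _
T-not∧⁺ {true}  f = f _

T-not⇒¬T : ∀ {x} → T (not x) → ¬ T x
T-not⇒¬T {false} _ ()

¬T⇒T-not : ∀ {x} → ¬ T x → T (not x)
¬T⇒T-not {false} _  = _
¬T⇒T-not {true}  ¬T = ¬T _

T-not-not⁻ : ∀ {x} → T (not (not x)) → T x
T-not-not⁻ {true} _ = _

T-not-not⁺ : ∀ {x} → T x → T (not (not x))
T-not-not⁺ {true} _ = _

allL⁻ : ∀ {A : Set} {p : A → Bool} {xs x} → T (allL p xs) → x ∈ xs → T (p x)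
allL⁻ {p = p} {y ∷ _} h (here refl) with p y
... | true = _
allL⁻ {p = p} {y ∷ _} h (there x∈) with p y
... | true = allL⁻ h x∈

allL⁺ : ∀ {A : Set} {p : A → Bool} xs → (∀ {x} → x ∈ xs → T (p x)) → T (allL p xs)
allL⁺ []       f = _
allL⁺ {p = p} (y ∷ ys) f with p y | f (here refl)
... | true | _ = allL⁺ ys (λ x∈ → f (there x∈))

allBelow⁻ : ∀ {m P i} → T (allBelow m P) → i < m → T (P i)
allBelow⁻ h i<m = allL⁻ h (∈-upTo⁺ i<m)

allBelow⁺ : ∀ {m P} → (∀ {i} → i < m → T (P i)) → T (allBelow m P)
allBelow⁺ {m} f = allL⁺ (upTo m) (λ i∈ → f (∈-upTo⁻ i∈))

T-dne : ∀ {x} → ¬ ¬ T x → T x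
T-dne {false} ¬¬Tx = ⊥-elim (¬¬Tx λ ())
T-dne {true}  _    = _

xor≡false⇒≡ : ∀ {x y} → x xor y ≡ false → x ≡ y
xor≡false⇒≡ {false} {false} _ = refl
xor≡false⇒≡ {true}  {true}  _ = refl

≡⇒xor≡false : ∀ {x y} → x ≡ y → x xor y ≡ false
≡⇒xor≡false {x} refl = xor-same x

<⇒<ᵇ≡true : ∀ {a b} → a < b → (a <ᵇ b) ≡ true
<⇒<ᵇ≡true a<b = Equivalence.to T-≡ (<⇒<ᵇ a<b)

<ᵇ≡true⇒< : ∀ {a b} → (a <ᵇ b) ≡ true → a < b
<ᵇ≡true⇒< {a} {b} e = <ᵇ⇒< a b (Equivalence.from T-≡ e)

<ᵇ≡false⇒≥ : ∀ {a b} → (a <ᵇ b) ≡ false → b ≤ a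
<ᵇ≡false⇒≥ e = ≮⇒≥ λ a<b → contradiction (trans (sym e) (<⇒<ᵇ≡true a<b)) λ ()

≥⇒<ᵇ≡false : ∀ {a b} → b ≤ a → (a <ᵇ b) ≡ false
≥⇒<ᵇ≡false {a} {b} b≤a with a <ᵇ b in eq
... | false = refl
... | true  = contradiction b≤a (<⇒≱ (<ᵇ≡true⇒< eq))

infix 4 _⊆[_]_ _≈[_]_

_⊆[_]_ : Part → ℕ → Part → Set
R ⊆[ m ] S = ∀ {i j} → i < m → j < m → T (R i j) → T (S i j)

_≈[_]_ : Part → ℕ → Part → Set
R ≈[ m ] S = ∀ {i j} → i < m → j < m → R i j ≡ S i j

record IsEquivalenceOn (m : ℕ) (R : Part) : Set where
  field
    reflexive  : ∀ {i} → i < m → T (R i i)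
    symmetric  : ∀ {i j} → i < m → j < m → T (R i j) → T (R j i)
    transitive : ∀ {i j k} → i < m → j < m → k < m → T (R i j) → T (R j k) → T (R i k)

NonCrossing : ℕ → Part → Set
NonCrossing m R = ∀ {a b c d} → a < b → b < c → c < d → d < m → T (R a c) → T (R b d) → T (R a b)

⊆-refl : ∀ {m R} → R ⊆[ m ] R
⊆-refl _ _ r = r

⊆-trans : ∀ {m R S U} → R ⊆[ m ] S → S ⊆[ m ] U → R ⊆[ m ] U
⊆-trans R⊆S S⊆U i<m j<m = S⊆U i<m j<m ∘′ R⊆S i<m j<m

⊆-antisym : ∀ {m R S} → R ⊆[ m ] S → S ⊆[ m ] R → R ≈[ m ] S
⊆-antisym R⊆S S⊆R i<m j<m = T-ext (R⊆S i<m j<m) (S⊆R i<m j<m)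

≈-refl : ∀ {m R} → R ≈[ m ] R
≈-refl _ _ = refl

≈-sym : ∀ {m R S} → R ≈[ m ] S → S ≈[ m ] R
≈-sym R≈S i<m j<m = sym (R≈S i<m j<m)

≈-trans : ∀ {m R S U} → R ≈[ m ] S → S ≈[ m ] U → R ≈[ m ] U
≈-trans R≈S S≈U i<m j<m = trans (R≈S i<m j<m) (S≈U i<m j<m)

≈⇒⊆ : ∀ {m R S} → R ≈[ m ] S → R ⊆[ m ] S
≈⇒⊆ R≈S i<m j<m = subst T (R≈S i<m j<m)

≈⇒⊇ : ∀ {m R S} → R ≈[ m ] S → S ⊆[ m ] R
≈⇒⊇ R≈S = ≈⇒⊆ (≈-sym R≈S)

NonCrossing-resp-≈ : ∀ {m R S} → R ≈[ m ] S → NonCrossing m R → NonCrossing m S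
NonCrossing-resp-≈ R≈S nc a<b b<c c<d d<m Sac Sbd =
  ≈⇒⊆ R≈S a<m b<m (nc a<b b<c c<d d<m (≈⇒⊇ R≈S a<m c<m Sac) (≈⇒⊇ R≈S b<m d<m Sbd))
  where
  c<m = <-trans c<d d<m
  b<m = <-trans b<c c<m
  a<m = <-trans a<b b<m

refines⇒⊆ : ∀ {m R S} → T (refines m R S) → R ⊆[ m ] S
refines⇒⊆ h i<m j<m = T-not∨⁻ (allBelow⁻ (allBelow⁻ h i<m) j<m)

⊆⇒refines : ∀ {m R S} → R ⊆[ m ] S → T (refines m R S)
⊆⇒refines R⊆S = allBelow⁺ λ i<m → allBelow⁺ λ j<m → T-not∨⁺ (R⊆S i<m j<m)

eqPart⇒≈ : ∀ {m R S} → T (eqPart m R S) → R ≈[ m ] S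
eqPart⇒≈ {R = R} {S} h {i} {j} i<m j<m with R i j | S i j | allBelow⁻ (allBelow⁻ h i<m) j<m
... | true  | true  | _ = refl
... | false | false | _ = refl

-- eqPart compares entries with a function local to Defs; on a one-point domain it reduces to
-- (entry ∧ true) ∧ true, which is how the entry test is reached here.
eqPart-one-point : ∀ {x y} → x ≡ y → T (eqPart 1 (λ _ _ → x) (λ _ _ → y))
eqPart-one-point {false} refl = _
eqPart-one-point {true}  refl = _

≈⇒eqPart : ∀ {m R S} → R ≈[ m ] S → T (eqPart m R S)
≈⇒eqPart R≈S = allBelow⁺ λ i<m → allBelow⁺ λ j<m →
  proj₁ (Equivalence.to T-∧ (proj₁ (Equivalence.to T-∧ (eqPart-one-point (R≈S i<m j<m)))))

nonCrossing⇒NonCrossing : ∀ {m R} → T (nonCrossing m R) → NonCrossing m R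
nonCrossing⇒NonCrossing {m} {R} h {a} {b} {c} {d} a<b b<c c<d d<m Rac Rbd =
  T-not-not⁻ (T-not∧⁻ (T-not∧⁻ (T-not∧⁻ (T-not∧⁻ (T-not∧⁻ crossing
    (<⇒<ᵇ a<b)) (<⇒<ᵇ b<c)) (<⇒<ᵇ c<d)) Rac) Rbd)
  where
  c<m : c < m
  c<m = <-trans c<d d<m
  b<m : b < m
  b<m = <-trans b<c c<m
  crossing : T (not ((a <ᵇ b) ∧ (b <ᵇ c) ∧ (c <ᵇ d) ∧ R a c ∧ R b d ∧ not (R a b)))
  crossing = allBelow⁻ {m} (allBelow⁻ {m} (allBelow⁻ {m} (allBelow⁻ {m} h (<-trans a<b b<m)) b<m) c<m) d<m

NonCrossing⇒nonCrossing : ∀ {m R} → NonCrossing m R → T (nonCrossing m R)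
NonCrossing⇒nonCrossing {m} nc =
  allBelow⁺ {m} λ {a} _ → allBelow⁺ {m} λ {b} _ → allBelow⁺ {m} λ {c} _ → allBelow⁺ {m} λ {d} d<m →
    T-not∧⁺ λ a<b → T-not∧⁺ λ b<c → T-not∧⁺ λ c<d → T-not∧⁺ λ Rac → T-not∧⁺ λ Rbd →
      T-not-not⁺ (nc (<ᵇ⇒< a b a<b) (<ᵇ⇒< b c b<c) (<ᵇ⇒< c d c<d) d<m Rac Rbd)

first : (ℕ → Bool) → ℕ → ℕ
first P zero    = zero
first P (suc k) = if P 0 then 0 else suc (first (P ∘ suc) k)

first-minimal : ∀ P k {j} → j < first P k → ¬ T (P j)
first-minimal P (suc k) {j} j<first with P 0 in eq
first-minimal P (suc k) {zero}  j<first | false = λ P0 → subst T eq P0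
first-minimal P (suc k) {suc j} (s≤s j<first) | false = first-minimal (P ∘ suc) k j<first

first-holds : ∀ P k → first P k < k → T (P (first P k))
first-holds P (suc k) first<k with P 0 in eq
... | true  = subst T (sym eq) _
... | false = first-holds (P ∘ suc) k (≤-pred first<k)

first-≤ : ∀ P k {j} → T (P j) → first P k ≤ j
first-≤ P k {j} Pj = ≮⇒≥ λ j<first → first-minimal P k j<first Pj

first-< : ∀ P k {j} → T (P j) → j < k → first P k < k
first-< P k Pj j<k = ≤-<-trans (first-≤ P k Pj) j<k

first-≡ : ∀ P k {c} → T (P c) → c < k → (∀ {j} → j < c → ¬ T (P j)) → first P k ≡ c
first-≡ P k Pc c<k below = ≤-antisym (first-≤ P k Pc)
  (≮⇒≥ λ first<c → below first<c (first-holds P k (<-trans first<c c<k)))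

first-cong : ∀ P Q k → (∀ {j} → j < k → P j ≡ Q j) → first P k ≡ first Q k
first-cong P Q zero    P≗Q = refl
first-cong P Q (suc k) P≗Q rewrite P≗Q {0} z<s with Q 0
... | true  = refl
... | false = cong suc (first-cong (P ∘ suc) (Q ∘ suc) k (P≗Q ∘ s≤s))

record GreatestBelow (P : ℕ → Bool) (j k : ℕ) : Set where
  field
    value   : ℕ
    ≥j      : j ≤ value
    <k      : value < k
    holds   : T (P value)
    maximal : ∀ {x} → value < x → x < k → ¬ T (P x)

greatestBelow : ∀ P {j} k → T (P j) → j < k → GreatestBelow P j k
greatestBelow P {j} (suc k) Pj j<1+k with P k in eq
... | true = record { value = k ; ≥j = ≤-pred j<1+k ; <k = ≤-refl ; holds = subst T (sym eq) _
                    ; maximal = λ k<x x<1+k → contradiction (≤-pred x<1+k) (<⇒≱ k<x) }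
... | false with m≤n⇒m<n∨m≡n (≤-pred j<1+k)
...   | inj₂ refl = contradiction (subst T eq Pj) λ ()
...   | inj₁ j<k = record
  { value = value ; ≥j = ≥j ; <k = m<n⇒m<1+n <k ; holds = holds
  ; maximal = λ v<x x<1+k → [ (λ x<k → maximal v<x x<k) , (λ { refl → λ Pk → subst T eq Pk }) ]′
                                 (m≤n⇒m<n∨m≡n (≤-pred x<1+k)) }
  where
  open GreatestBelow (greatestBelow P k Pj j<k)

lookupD-snoc< : ∀ xs {x i} → i < length xs → lookupD (xs ++ [ x ]) i ≡ lookupD xs i
lookupD-snoc< (y ∷ ys) {i = zero}  _          = refl
lookupD-snoc< (y ∷ ys) {i = suc i} (s≤s i<n) = lookupD-snoc< ys i<n

lookupD-snoc-last : ∀ xs {x} → lookupD (xs ++ [ x ]) (length xs) ≡ x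
lookupD-snoc-last []       = refl
lookupD-snoc-last (_ ∷ ys) = lookupD-snoc-last ys

lookupD-ext : ∀ xs ys → length xs ≡ length ys →
              (∀ {i} → i < length xs → lookupD xs i ≡ lookupD ys i) → xs ≡ ys
lookupD-ext []       []       _  _  = refl
lookupD-ext (x ∷ xs) (y ∷ ys) eq pw = cong₂ _∷_ (pw z<s) (lookupD-ext xs ys (suc-injective eq) (pw ∘ s≤s))

length-snoc : ∀ xs {x : ℕ} → length (xs ++ [ x ]) ≡ suc (length xs)
length-snoc xs = trans (length-++ xs) (+-comm _ 1)

extensions : ℕ → List ℕ → List (List ℕ)
extensions k l = map (λ x → l ++ [ x ]) (upTo (suc k))

IsLabelList : ℕ → List ℕ → Set
IsLabelList k l = length l ≡ k × (∀ {i} → i < k → lookupD l i ≤ i)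

∈labelLists⇒ : ∀ k {l} → l ∈ labelLists k → IsLabelList k l
∈labelLists⇒ zero    (here refl) = refl , λ ()
∈labelLists⇒ (suc k) l∈ with find (∈-concatMap⁻ (extensions k) {xs = labelLists k} l∈)
... | l₀ , l₀∈ , l∈ext with ∈-map⁻ (λ x → l₀ ++ [ x ]) l∈ext | ∈labelLists⇒ k l₀∈
...   | x , x∈ , refl | refl , bounded = length-snoc l₀ , bounded′
  where
  bounded′ : ∀ {i} → i < suc (length l₀) → lookupD (l₀ ++ [ x ]) i ≤ i
  bounded′ {i} i≤k with m≤n⇒m<n∨m≡n (≤-pred i≤k)
  ... | inj₁ i<k  = subst (_≤ i) (sym (lookupD-snoc< l₀ i<k)) (bounded i<k)
  ... | inj₂ refl = subst (_≤ i) (sym (lookupD-snoc-last l₀)) (≤-pred (∈-upTo⁻ x∈))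

labelLists-unique : ∀ k → Unique (labelLists k)
labelLists-unique zero    = All.[] ∷ AllPairs.[]
labelLists-unique (suc k) = Unique.concat⁺
  (All.map⁺ (All.tabulate λ {l} _ → Unique.map⁺ (proj₂ ∘ ∷ʳ-injective l l) (Unique.upTo⁺ (suc k))))
  (AllPairs.map⁺ (AllPairs.map disjoint (labelLists-unique k)))
  where
  disjoint : ∀ {l l′} → l ≢ l′ → Disjoint (extensions k l) (extensions k l′)
  disjoint {l} {l′} l≢l′ (∈l , ∈l′) with ∈-map⁻ _ ∈l | ∈-map⁻ _ ∈l′
  ... | _ , _ , refl | _ , _ , eq = l≢l′ (proj₁ (∷ʳ-injective l l′ eq))

blockMin : ℕ → Part → ℕ → ℕ
blockMin m R i = first (R i) m

canonicalLabels : ℕ → Part → ℕ → List ℕ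
canonicalLabels m R zero    = []
canonicalLabels m R (suc k) = canonicalLabels m R k ++ [ blockMin m R k ]

length-canonicalLabels : ∀ m R k → length (canonicalLabels m R k) ≡ k
length-canonicalLabels m R zero    = refl
length-canonicalLabels m R (suc k) =
  trans (length-snoc (canonicalLabels m R k)) (cong suc (length-canonicalLabels m R k))

lookupD-canonicalLabels : ∀ m R {k i} → i < k → lookupD (canonicalLabels m R k) i ≡ blockMin m R i
lookupD-canonicalLabels m R {suc k} {i} i≤k with m≤n⇒m<n∨m≡n (≤-pred i≤k)
... | inj₁ i<k  = trans (lookupD-snoc< (canonicalLabels m R k) (subst (i <_) (sym (length-canonicalLabels m R k)) i<k))
                        (lookupD-canonicalLabels m R i<k)
... | inj₂ refl = subst (λ j → lookupD (canonicalLabels m R (suc i)) j ≡ blockMin m R i)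
                        (length-canonicalLabels m R i) (lookupD-snoc-last (canonicalLabels m R i))

canonicalLabels∈labelLists : ∀ m R k → (∀ {i} → i < k → blockMin m R i ≤ i) → canonicalLabels m R k ∈ labelLists k
canonicalLabels∈labelLists m R zero    _       = here refl
canonicalLabels∈labelLists m R (suc k) min≤ = ∈-concatMap⁺ (extensions k)
  (Any.map (λ { refl → ∈-map⁺ (λ x → canonicalLabels m R k ++ [ x ]) (∈-upTo⁺ (s≤s (min≤ ≤-refl))) })
           (canonicalLabels∈labelLists m R k (min≤ ∘ m<n⇒m<1+n)))

toPart-isEquivalence : ∀ {m} l → IsEquivalenceOn m (toPart l)
toPart-isEquivalence l = record
  { reflexive  = λ {i} _ → ≡⇒≡ᵇ (lookupD l i) _ refl
  ; symmetric  = λ {i} {j} _ _ ij → ≡⇒≡ᵇ (lookupD l j) _ (sym (≡ᵇ⇒≡ (lookupD l i) _ ij))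
  ; transitive = λ {i} {j} _ _ _ ij jk →
      ≡⇒≡ᵇ (lookupD l i) _ (trans (≡ᵇ⇒≡ (lookupD l i) _ ij) (≡ᵇ⇒≡ (lookupD l j) _ jk)) }

module Canonical {m R} (eqv : IsEquivalenceOn m R) where
  open IsEquivalenceOn eqv

  labels : List ℕ
  labels = canonicalLabels m R m

  blockMin-≤ : ∀ {i} → i < m → blockMin m R i ≤ i
  blockMin-≤ i<m = first-≤ (R _) m (reflexive i<m)

  blockMin-< : ∀ {i} → i < m → blockMin m R i < m
  blockMin-< i<m = first-< (R _) m (reflexive i<m) i<m

  blockMin-related : ∀ {i} → i < m → T (R i (blockMin m R i))
  blockMin-related i<m = first-holds (R _) m (blockMin-< i<m)

  blockMin-cong : ∀ {i j} → i < m → j < m → T (R i j) → blockMin m R i ≡ blockMin m R j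
  blockMin-cong i<m j<m Rij = first-cong (R _) (R _) m λ x<m →
    T-ext (transitive j<m i<m x<m (symmetric i<m j<m Rij)) (transitive i<m j<m x<m Rij)

  lookupD-labels : ∀ {i} → i < m → lookupD labels i ≡ blockMin m R i
  lookupD-labels = lookupD-canonicalLabels m R

  labels∈labelLists : labels ∈ labelLists m
  labels∈labelLists = canonicalLabels∈labelLists m R m blockMin-≤

  toPart-labels≈ : toPart labels ≈[ m ] R
  toPart-labels≈ {i} {j} i<m j<m = T-ext same⇒R R⇒same
    where
    same⇒R : T (toPart labels i j) → T (R i j)
    same⇒R same = transitive i<m (blockMin-< i<m) j<m (blockMin-related i<m)
      (subst (λ b → T (R b j)) (sym mins≡)
        (symmetric j<m (blockMin-< j<m) (blockMin-related j<m)))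
      where
      mins≡ : blockMin m R i ≡ blockMin m R j
      mins≡ = trans (sym (lookupD-labels i<m))
                (trans (≡ᵇ⇒≡ (lookupD labels i) _ same) (lookupD-labels j<m))
    R⇒same : T (R i j) → T (toPart labels i j)
    R⇒same Rij = ≡⇒≡ᵇ (lookupD labels i) _
      (trans (lookupD-labels i<m) (trans (blockMin-cong i<m j<m Rij) (sym (lookupD-labels j<m))))

  labels-isCanonical : T (isCanonical m labels)
  labels-isCanonical = allBelow⁺ λ {i} i<m →
    let c<m = blockMin-< i<m in
    ≡⇒≡ᵇ (lookupD labels (lookupD labels i)) _
      (trans (cong (lookupD labels) (lookupD-labels i<m))
        (trans (lookupD-labels c<m)
          (trans (sym (blockMin-cong i<m c<m (blockMin-related i<m))) (sym (lookupD-labels i<m)))))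

  labels-unique : ∀ {l} → l ∈ labelLists m → T (isCanonical m l) → toPart l ≈[ m ] R → l ≡ labels
  labels-unique {l} l∈ canon l≈R =
    lookupD-ext l labels (trans length-l (sym (length-canonicalLabels m R m)))
      λ i<len → let i<m = subst (_ <_) length-l i<len in
        trans (label≡blockMin i<m) (sym (lookupD-labels i<m))
    where
    length-l = proj₁ (∈labelLists⇒ m l∈)
    label≤ = proj₂ (∈labelLists⇒ m l∈)
    label≡blockMin : ∀ {i} → i < m → lookupD l i ≡ blockMin m R i
    label≡blockMin {i} i<m = sym (first-≡ (R i) m Ric c<m below)
      where
      c = lookupD l i
      c<m = ≤-<-trans (label≤ i<m) i<m
      Ric : T (R i c)
      Ric = subst T (l≈R i<m c<m)
        (≡⇒≡ᵇ c _ (sym (≡ᵇ⇒≡ (lookupD l c) _ (allBelow⁻ canon i<m))))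
      below : ∀ {j} → j < c → ¬ T (R i j)
      below {j} j<c Rij = <⇒≱ j<c (subst (_≤ j) label-j≡c (label≤ j<m))
        where
        j<m = <-trans j<c c<m
        label-j≡c : lookupD l j ≡ c
        label-j≡c = sym (≡ᵇ⇒≡ c _ (subst T (sym (l≈R i<m j<m)) Rij))

count-map : ∀ {A B : Set} (p : B → Bool) (f : A → B) xs → count p (map f xs) ≡ count (p ∘ f) xs
count-map p f []       = refl
count-map p f (x ∷ xs) with p (f x)
... | true  = cong suc (count-map p f xs)
... | false = count-map p f xs

count≡0 : ∀ {A : Set} {p : A → Bool} {xs} → (∀ {x} → x ∈ xs → ¬ T (p x)) → count p xs ≡ 0
count≡0 {p = p} none = cong length (filter-none (T? ∘ p) (All.tabulate none))

count≡1 : ∀ {A : Set} {p : A → Bool} {xs c} → Unique xs → c ∈ xs → T (p c) →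
          (∀ {x} → x ∈ xs → T (p x) → x ≡ c) → count p xs ≡ 1
count≡1 {p = p} (y∉ys ∷ _) (here refl) pc only =
  trans (cong length (filter-accept (T? ∘ p) pc))
        (cong suc (count≡0 λ x∈ px → All.lookup y∉ys x∈ (sym (only (there x∈) px))))
count≡1 {p = p} (y∉ys ∷ ys-unique) (there c∈) pc only =
  trans (cong length (filter-reject (T? ∘ p) λ py → All.lookup y∉ys c∈ (only (here refl) py)))
        (count≡1 ys-unique c∈ pc (only ∘ there))

findᵇ-just : ∀ {A : Set} (p : A → Bool) xs {y} → findᵇ p xs ≡ just y → y ∈ xs × T (p y)
findᵇ-just p (x ∷ xs) eq with p x in px
findᵇ-just p (x ∷ xs) refl | true = here refl , subst T (sym px) _
... | false = let y∈ , py = findᵇ-just p xs eq in there y∈ , py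

findᵇ-complete : ∀ {A : Set} (p : A → Bool) {xs x} → x ∈ xs → T (p x) → ∃ λ y → findᵇ p xs ≡ just y
findᵇ-complete p {y ∷ _} x∈ px with p y in py
... | true = y , refl
findᵇ-complete p (here refl) px | false = contradiction (subst T py px) λ ()
findᵇ-complete p (there x∈) px | false = findᵇ-complete p x∈ px

isNCPLabelList : ℕ → List ℕ → Bool
isNCPLabelList m l = isCanonical m l ∧ nonCrossing m (toPart l)

∈NCP⇒ : ∀ {m π} → π ∈ NCP m → ∃ λ l → l ∈ labelLists m × π ≡ toPart l × T (isNCPLabelList m l)
∈NCP⇒ {m} = ∈-map∘filter⁻ toPart (T? ∘ isNCPLabelList m)

∈NCP⇒isEquivalence : ∀ {m π} → π ∈ NCP m → IsEquivalenceOn m π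
∈NCP⇒isEquivalence {m} π∈ with ∈NCP⇒ {m} π∈
... | l , _ , refl , _ = toPart-isEquivalence l

∈NCP⇒nonCrossing : ∀ {m π} → π ∈ NCP m → NonCrossing m π
∈NCP⇒nonCrossing {m} π∈ with ∈NCP⇒ {m} π∈
... | l , _ , refl , ok = nonCrossing⇒NonCrossing (proj₂ (Equivalence.to T-∧ ok))

module _ {m R} (eqv : IsEquivalenceOn m R) (nc : NonCrossing m R) where
  open Canonical eqv

  private
    labels-ok : T (isNCPLabelList m labels)
    labels-ok = Equivalence.from T-∧
      (labels-isCanonical , NonCrossing⇒nonCrossing (NonCrossing-resp-≈ (≈-sym toPart-labels≈) nc))

  representative∈NCP : toPart labels ∈ NCP m
  representative∈NCP = ∈-map⁺ toPart (∈-filter⁺ (T? ∘ isNCPLabelList m) labels∈labelLists labels-ok)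

  count-NCP≡1 : ∀ (p : Part → Bool) → (∀ {π} → π ∈ NCP m → T (p π) → π ≈[ m ] R) →
                (∀ {π} → π ∈ NCP m → π ≈[ m ] R → T (p π)) → count p (NCP m) ≡ 1
  count-NCP≡1 p sound complete =
    trans (count-map p toPart (filter (T? ∘ isNCPLabelList m) (labelLists m)))
      (count≡1 (Unique.filter⁺ (T? ∘ isNCPLabelList m) (labelLists-unique m))
        (∈-filter⁺ (T? ∘ isNCPLabelList m) labels∈labelLists labels-ok)
        (complete representative∈NCP toPart-labels≈)
        only)
    where
    only : ∀ {l} → l ∈ filter (T? ∘ isNCPLabelList m) (labelLists m) → T (p (toPart l)) → l ≡ labels
    only l∈ pl with ∈-filter⁻ (T? ∘ isNCPLabelList m) l∈
    ... | l∈labelLists , ok =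
      labels-unique l∈labelLists (proj₁ (Equivalence.to T-∧ ok)) (sound (∈-map⁺ toPart l∈) pl)

-- The interleaving α ∗ γ and admissibility

data Parity : ℕ → Set where
  even : ∀ x → Parity (2 * x)
  odd  : ∀ x → Parity (2 * x + 1)

parity : ∀ p → Parity p
parity zero = even 0
parity (suc p) with parity p
... | even x = subst Parity (+-comm (2 * x) 1) (odd x)
... | odd x  = subst Parity (trans (*-suc 2 x) (cong suc (+-comm 1 (2 * x)))) (even (suc x))

half-double : ∀ x → ⌊ 2 * x /2⌋ ≡ x
half-double zero    = refl
half-double (suc x) = trans (cong ⌊_/2⌋ (*-suc 2 x)) (cong suc (half-double x))

half-double+1 : ∀ x → ⌊ 2 * x + 1 /2⌋ ≡ x
half-double+1 zero    = refl
half-double+1 (suc x) = trans (cong (λ k → ⌊ k + 1 /2⌋) (*-suc 2 x)) (cong suc (half-double+1 x))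

isEven-double : ∀ x → isEven (2 * x) ≡ true
isEven-double x = cong (_≡ᵇ 0) (trans (cong (_% 2) (*-comm 2 x)) (m*n%n≡0 x 2))

isEven-double+1 : ∀ x → isEven (2 * x + 1) ≡ false
isEven-double+1 x = cong (_≡ᵇ 0)
  (trans (cong (_% 2) (trans (+-comm (2 * x) 1) (cong suc (*-comm 2 x)))) ([m+kn]%n≡m%n 1 x 2))

double-mono-< : ∀ {x y} → x < y → 2 * x < 2 * y
double-mono-< = *-monoʳ-< 2

double-cancel-< : ∀ {x y} → 2 * x < 2 * y → x < y
double-cancel-< {x} {y} = *-cancelˡ-< 2 x y

double+1-mono-< : ∀ {x y} → x < y → 2 * x + 1 < 2 * y + 1
double+1-mono-< x<y = +-monoˡ-< 1 (double-mono-< x<y)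

double+1-cancel-< : ∀ {x y} → 2 * x + 1 < 2 * y + 1 → x < y
double+1-cancel-< {x} {y} h = double-cancel-< (+-cancelʳ-< 1 (2 * x) (2 * y) h)

double<double+1 : ∀ {x y} → x ≤ y → 2 * x < 2 * y + 1
double<double+1 {x} {y} x≤y = subst (2 * x <_) (+-comm 1 (2 * y)) (s≤s (*-monoʳ-≤ 2 x≤y))

double<double+1⁻ : ∀ {x y} → 2 * x < 2 * y + 1 → x ≤ y
double<double+1⁻ {x} {y} h = *-cancelˡ-≤ 2 (≤-pred (subst (2 * x <_) (+-comm (2 * y) 1) h))

double+1<double : ∀ {x y} → x < y → 2 * x + 1 < 2 * y
double+1<double {x} {y} x<y = subst (_≤ 2 * y) (cong suc (+-comm 1 (2 * x)))
  (subst (_≤ 2 * y) (*-suc 2 x) (*-monoʳ-≤ 2 x<y))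

double+1<double⁻ : ∀ {x y} → 2 * x + 1 < 2 * y → x < y
double+1<double⁻ {x} h = double-cancel-< (<-trans (m<m+n (2 * x) z<s) h)

module _ (α γ : Part) (x y : ℕ) where

  star-even-even : star α γ (2 * x) (2 * y) ≡ α x y
  star-even-even rewrite isEven-double x | isEven-double y | half-double x | half-double y = refl

  star-odd-odd : star α γ (2 * x + 1) (2 * y + 1) ≡ γ x y
  star-odd-odd rewrite isEven-double+1 x | isEven-double+1 y | half-double+1 x | half-double+1 y = refl

  star-even-odd : star α γ (2 * x) (2 * y + 1) ≡ false
  star-even-odd rewrite isEven-double x | isEven-double+1 y = refl

  star-odd-even : star α γ (2 * x + 1) (2 * y) ≡ false
  star-odd-even rewrite isEven-double+1 x | isEven-double y = refl

Saturated : ℕ → Part → (ℕ → Bool) → Set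
Saturated n R S = ∀ {u v} → u < n → v < n → T (R u v) → S u ≡ S v

saturated-antitone : ∀ {n R R′ S} → R′ ⊆[ n ] R → Saturated n R S → Saturated n R′ S
saturated-antitone R′⊆R sat u<n v<n = sat u<n v<n ∘ R′⊆R u<n v<n

saturated-≗ : ∀ {n R S S′} → (∀ p → S p ≡ S′ p) → Saturated n R S → Saturated n R S′
saturated-≗ S≗S′ sat {u} {v} u<n v<n Ruv = trans (sym (S≗S′ u)) (trans (sat u<n v<n Ruv) (S≗S′ v))

saturated-op : ∀ {n R S S′} (f : Bool → Bool → Bool) →
               Saturated n R S → Saturated n R S′ → Saturated n R (λ p → f (S p) (S′ p))
saturated-op f sat sat′ u<n v<n Ruv = cong₂ f (sat u<n v<n Ruv) (sat′ u<n v<n Ruv)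

saturated-by-implication : ∀ {n R S} → IsEquivalenceOn n R →
                           (∀ {u v} → u < n → v < n → T (R u v) → T (S u) → T (S v)) → Saturated n R S
saturated-by-implication eqv imp u<n v<n Ruv =
  T-ext (imp u<n v<n Ruv) (imp v<n u<n (IsEquivalenceOn.symmetric eqv u<n v<n Ruv))

-- α lives on the even points and γ on the odd points of [2n], i.e. in the order
-- 0 < 0′ < 1 < 1′ < ⋯.  insideγ y w p: the point p lies strictly between y′ and w′;
-- insideα u v y: the point y′ lies strictly between u and v.
insideγ : ℕ → ℕ → ℕ → Bool
insideγ y w p = (y <ᵇ p) xor (w <ᵇ p)

insideα : ℕ → ℕ → ℕ → Bool
insideα u v y = (y <ᵇ u) xor (y <ᵇ v)

Compatible : ℕ → Part → Part → Set
Compatible n α γ = ∀ {y w} → y < n → w < n → T (γ y w) → Saturated n α (insideγ y w)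

insideγ-comm : ∀ y w p → insideγ y w p ≡ insideγ w y p
insideγ-comm y w p = xor-comm (y <ᵇ p) (w <ᵇ p)

insideγ-interchange : ∀ y w u v → insideγ y w u xor insideγ y w v ≡ insideα u v y xor insideα u v w
insideγ-interchange y w u v = interchange (y <ᵇ u) (w <ᵇ u) (y <ᵇ v) (w <ᵇ v)

compatible⇒saturatedᵅ : ∀ {n α γ} → Compatible n α γ →
                       ∀ {u v} → u < n → v < n → T (α u v) → Saturated n γ (insideα u v)
compatible⇒saturatedᵅ compat {u} {v} u<n v<n αuv {y} {w} y<n w<n γyw = xor≡false⇒≡
  (trans (sym (insideγ-interchange y w u v)) (≡⇒xor≡false (compat y<n w<n γyw u<n v<n αuv)))

saturatedᵅ⇒compatible : ∀ {n α γ} → (∀ {u v} → u < n → v < n → T (α u v) → Saturated n γ (insideα u v)) →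
                       Compatible n α γ
saturatedᵅ⇒compatible sat {y} {w} y<n w<n γyw {u} {v} u<n v<n αuv = xor≡false⇒≡
  (trans (insideγ-interchange y w u v) (≡⇒xor≡false (sat u<n v<n αuv y<n w<n γyw)))

compatible-antitoneˡ : ∀ {n α α′ γ} → α′ ⊆[ n ] α → Compatible n α γ → Compatible n α′ γ
compatible-antitoneˡ α′⊆α compat y<n w<n γyw = saturated-antitone α′⊆α (compat y<n w<n γyw)

compatible-antitoneʳ : ∀ {n α γ γ′} → γ′ ⊆[ n ] γ → Compatible n α γ → Compatible n α γ′
compatible-antitoneʳ γ′⊆γ compat y<n w<n γ′yw = compat y<n w<n (γ′⊆γ y<n w<n γ′yw)

compatible-resp-≈ : ∀ {n α α′ γ γ′} → α ≈[ n ] α′ → γ ≈[ n ] γ′ → Compatible n α γ → Compatible n α′ γ′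
compatible-resp-≈ α≈α′ γ≈γ′ = compatible-antitoneˡ (≈⇒⊇ α≈α′) ∘ compatible-antitoneʳ (≈⇒⊇ γ≈γ′)

-- the two ways in which the α-chord x–z crosses the γ-chord y′–w′: x < y′ < z < w′ or y′ < x < w′ < z
data Crossing (x z y w : ℕ) : Set where
  α-first : x ≤ y → y < z → z ≤ w → Crossing x z y w
  γ-first : y < x → x ≤ w → w < z → Crossing x z y w

record MixedCrossing (n : ℕ) (α γ : Part) : Set where
  field
    {x z y w} : ℕ
    x<n       : x < n
    z<n       : z < n
    y<n       : y < n
    w<n       : w < n
    αxz       : T (α x z)
    γyw       : T (γ y w)
    crossing  : Crossing x z y w

insideγ-true : ∀ {y w p} → y ≤ w → T (insideγ y w p) → y < p × p ≤ w
insideγ-true {y} {w} {p} y≤w inside with y <ᵇ p in yp | w <ᵇ p in wp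
insideγ-true y≤w () | true  | true
insideγ-true y≤w _  | true  | false = <ᵇ≡true⇒< yp , <ᵇ≡false⇒≥ wp
insideγ-true {y} {w} {p} y≤w _  | false | true  =
  contradiction (≤-<-trans (≤-trans (<ᵇ≡false⇒≥ {y} {p} yp) y≤w) (<ᵇ≡true⇒< {w} {p} wp)) (<-irrefl refl)
insideγ-true y≤w () | false | false

insideγ-false : ∀ {y w p} → ¬ T (insideγ y w p) → p ≤ y ⊎ w < p
insideγ-false {y} {w} {p} outside with y <ᵇ p in yp | w <ᵇ p in wp
... | true  | true  = inj₂ (<ᵇ≡true⇒< wp)
... | true  | false = contradiction _ outside
... | false | true  = contradiction _ outside
... | false | false = inj₁ (<ᵇ≡false⇒≥ yp)

crossing⇒separated : ∀ {x z y w} → Crossing x z y w → insideγ y w x ≢ insideγ y w z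
crossing⇒separated (α-first x≤y y<z z≤w)
  rewrite ≥⇒<ᵇ≡false x≤y | ≥⇒<ᵇ≡false (≤-trans x≤y (≤-trans (<⇒≤ y<z) z≤w))
        | <⇒<ᵇ≡true y<z | ≥⇒<ᵇ≡false z≤w = λ ()
crossing⇒separated (γ-first y<x x≤w w<z)
  rewrite <⇒<ᵇ≡true y<x | ≥⇒<ᵇ≡false x≤w
        | <⇒<ᵇ≡true (<-trans y<x (≤-<-trans x≤w w<z)) | <⇒<ᵇ≡true w<z = λ ()

separated⇒crossing : ∀ {y w u v} → y ≤ w → T (insideγ y w u) → ¬ T (insideγ y w v) →
                     Crossing v u y w ⊎ Crossing u v y w
separated⇒crossing {y} {w} {u} {v} y≤w inU outV with insideγ-true {p = u} y≤w inU | insideγ-false {y} {w} {v} outV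
... | y<u , u≤w | inj₁ v≤y = inj₁ (α-first v≤y y<u u≤w)
... | y<u , u≤w | inj₂ w<v = inj₂ (γ-first y<u u≤w w<v)

compatible⇒noMixedCrossing : ∀ {n α γ} → Compatible n α γ → ¬ MixedCrossing n α γ
compatible⇒noMixedCrossing compat χ = crossing⇒separated crossing (compat y<n w<n γyw x<n z<n αxz)
  where open MixedCrossing χ

noMixedCrossing⇒compatible : ∀ {n α γ} → IsEquivalenceOn n α → IsEquivalenceOn n γ →
                             ¬ MixedCrossing n α γ → Compatible n α γ
noMixedCrossing⇒compatible {n} {α} {γ} eqα eqγ noCrossing {y} {w} y<n w<n γyw {u} {v} u<n v<n αuv =
  case ≤-total y w of λ where
    (inj₁ y≤w) → agree y≤w y<n w<n γyw
    (inj₂ w≤y) → trans (insideγ-comm y w u)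
                   (trans (agree w≤y w<n y<n (G.symmetric y<n w<n γyw)) (sym (insideγ-comm y w v)))
  where
  module A = IsEquivalenceOn eqα
  module G = IsEquivalenceOn eqγ
  oneWay : ∀ {y w u v} → y ≤ w → y < n → w < n → T (γ y w) → u < n → v < n → T (α u v) →
           T (insideγ y w u) → T (insideγ y w v)
  oneWay y≤w y<n w<n γyw u<n v<n αuv inU = T-dne λ outV → noCrossing (mixed (separated⇒crossing y≤w inU outV))
    where
    mixed : Crossing _ _ _ _ ⊎ Crossing _ _ _ _ → MixedCrossing n α γ
    mixed (inj₁ c) = record { x<n = v<n ; z<n = u<n ; y<n = y<n ; w<n = w<n
                            ; αxz = A.symmetric u<n v<n αuv ; γyw = γyw ; crossing = c }
    mixed (inj₂ c) = record { x<n = u<n ; z<n = v<n ; y<n = y<n ; w<n = w<n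
                            ; αxz = αuv ; γyw = γyw ; crossing = c }
  agree : ∀ {y w} → y ≤ w → y < n → w < n → T (γ y w) → insideγ y w u ≡ insideγ y w v
  agree y≤w y<n w<n γyw =
    T-ext (oneWay y≤w y<n w<n γyw u<n v<n αuv) (oneWay y≤w y<n w<n γyw v<n u<n (A.symmetric u<n v<n αuv))

module _ {n : ℕ} {α γ : Part} where

  admissible⇒starNonCrossing : T (admissible n α γ) → NonCrossing (2 * n) (star α γ)
  admissible⇒starNonCrossing = nonCrossing⇒NonCrossing

  admissible⇒noMixedCrossing : T (admissible n α γ) → ¬ MixedCrossing n α γ
  admissible⇒noMixedCrossing adm χ with MixedCrossing.crossing χ
  ... | α-first x≤y y<z z≤w =
    subst T (star-even-odd α γ x y)
      (admissible⇒starNonCrossing adm (double<double+1 x≤y) (double+1<double y<z) (double<double+1 z≤w) (double+1<double w<n)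
        (subst T (sym (star-even-even α γ x z)) αxz) (subst T (sym (star-odd-odd α γ y w)) γyw))
    where open MixedCrossing χ
  ... | γ-first y<x x≤w w<z =
    subst T (star-odd-even α γ y x)
      (admissible⇒starNonCrossing adm (double+1<double y<x) (double<double+1 x≤w) (double+1<double w<z) (double-mono-< z<n)
        (subst T (sym (star-odd-odd α γ y w)) γyw) (subst T (sym (star-even-even α γ x z)) αxz))
    where open MixedCrossing χ

  noMixedCrossing⇒admissible : NonCrossing n α → NonCrossing n γ → ¬ MixedCrossing n α γ → T (admissible n α γ)
  noMixedCrossing⇒admissible ncα ncγ noCrossing = NonCrossing⇒nonCrossing ncStar
    where
    ncStar : NonCrossing (2 * n) (star α γ)
    ncStar {a} {b} {c} {d} a<b b<c c<d d<2n Sac Sbd with parity a | parity b | parity c | parity d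
    ... | even a | even b | even c | even d =
      subst T (sym (star-even-even α γ a b))
        (ncα (double-cancel-< a<b) (double-cancel-< b<c) (double-cancel-< c<d) (double-cancel-< d<2n)
          (subst T (star-even-even α γ a c) Sac) (subst T (star-even-even α γ b d) Sbd))
    ... | odd a | odd b | odd c | odd d =
      subst T (sym (star-odd-odd α γ a b))
        (ncγ (double+1-cancel-< a<b) (double+1-cancel-< b<c) (double+1-cancel-< c<d) (double+1<double⁻ d<2n)
          (subst T (star-odd-odd α γ a c) Sac) (subst T (star-odd-odd α γ b d) Sbd))
    ... | even x | odd y | even z | odd w = ⊥-elim (noCrossing record
      { x<n = <-trans x<z z<n ; z<n = z<n ; y<n = <-trans y<w w<n ; w<n = w<n
      ; αxz = subst T (star-even-even α γ x z) Sac ; γyw = subst T (star-odd-odd α γ y w) Sbd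
      ; crossing = α-first (double<double+1⁻ a<b) y<z (double<double+1⁻ c<d) })
      where
      y<z = double+1<double⁻ b<c
      z≤w = double<double+1⁻ c<d
      w<n = double+1<double⁻ d<2n
      z<n = ≤-<-trans z≤w w<n
      x<z = ≤-<-trans (double<double+1⁻ a<b) y<z
      y<w = <-≤-trans y<z z≤w
    ... | odd y | even x | odd w | even z = ⊥-elim (noCrossing record
      { x<n = <-trans x<z z<n ; z<n = z<n ; y<n = <-trans y<x (<-trans x<z z<n) ; w<n = <-trans w<z z<n
      ; αxz = subst T (star-even-even α γ x z) Sbd ; γyw = subst T (star-odd-odd α γ y w) Sac
      ; crossing = γ-first y<x x≤w w<z })
      where
      y<x = double+1<double⁻ a<b
      x≤w = double<double+1⁻ b<c
      w<z = double+1<double⁻ c<d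
      z<n = double-cancel-< d<2n
      x<z = ≤-<-trans x≤w w<z
    ... | even a | _ | odd c | _ = ⊥-elim (subst T (star-even-odd α γ a c) Sac)
    ... | odd a  | _ | even c | _ = ⊥-elim (subst T (star-odd-even α γ a c) Sac)
    ... | _ | even b | _ | odd d  = ⊥-elim (subst T (star-even-odd α γ b d) Sbd)
    ... | _ | odd b  | _ | even d = ⊥-elim (subst T (star-odd-even α γ b d) Sbd)

admissible⇒compatible : ∀ {n α γ} → IsEquivalenceOn n α → IsEquivalenceOn n γ →
                        T (admissible n α γ) → Compatible n α γ
admissible⇒compatible eqα eqγ = noMixedCrossing⇒compatible eqα eqγ ∘ admissible⇒noMixedCrossing

compatible⇒admissible : ∀ {n α γ} → NonCrossing n α → NonCrossing n γ → Compatible n α γ → T (admissible n α γ)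
compatible⇒admissible ncα ncγ = noMixedCrossing⇒admissible ncα ncγ ∘ compatible⇒noMixedCrossing

-- Joins

upperBound⇒ : ∀ {m R S ν} → T (upperBound m R S ν) → R ⊆[ m ] ν × S ⊆[ m ] ν
upperBound⇒ {m} {R} {S} {ν} ub with Equivalence.to (T-∧ {refines m R ν} {refines m S ν}) ub
... | R⊆ν , S⊆ν = refines⇒⊆ {m} {R} {ν} R⊆ν , refines⇒⊆ {m} {S} {ν} S⊆ν

⇒upperBound : ∀ {m R S ν} → R ⊆[ m ] ν → S ⊆[ m ] ν → T (upperBound m R S ν)
⇒upperBound R⊆ν S⊆ν = Equivalence.from T-∧ (⊆⇒refines R⊆ν , ⊆⇒refines S⊆ν)

isLeastUpperBound : ℕ → Part → Part → Part → Bool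
isLeastUpperBound m R S μ =
  upperBound m R S μ ∧ allL (λ ν → not (upperBound m R S ν) ∨ refines m μ ν) (NCP m)

joinNC-found : ∀ m R S {μ} → findᵇ (isLeastUpperBound m R S) (NCP m) ≡ just μ → joinNC m R S ≡ μ
joinNC-found m R S eq rewrite eq = refl

joinNC-≈ : ∀ {m R S U} → IsEquivalenceOn m U → NonCrossing m U → R ⊆[ m ] U → S ⊆[ m ] U →
           (∀ {ν} → ν ∈ NCP m → R ⊆[ m ] ν → S ⊆[ m ] ν → U ⊆[ m ] ν) → joinNC m R S ≈[ m ] U
joinNC-≈ {m} {R} {S} {U} eqv nc R⊆U S⊆U least =
  let μ , found = findᵇ-complete (isLeastUpperBound m R S) (representative∈NCP eqv nc) representative-lub
  in subst (_≈[ m ] U) (sym (joinNC-found m R S found)) (found⇒≈ found)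
  where
  open Canonical eqv
  representative-ub : T (upperBound m R S (toPart labels))
  representative-ub = ⇒upperBound (⊆-trans R⊆U (≈⇒⊇ toPart-labels≈)) (⊆-trans S⊆U (≈⇒⊇ toPart-labels≈))
  representative-lub : T (isLeastUpperBound m R S (toPart labels))
  representative-lub = Equivalence.from T-∧
    ( representative-ub
    , allL⁺ (NCP m) λ ν∈ → T-not∨⁺ λ ub → let R⊆ν , S⊆ν = upperBound⇒ {m} {R} {S} ub in
        ⊆⇒refines (⊆-trans (≈⇒⊆ toPart-labels≈) (least ν∈ R⊆ν S⊆ν)))
  found⇒≈ : ∀ {μ} → findᵇ (isLeastUpperBound m R S) (NCP m) ≡ just μ → μ ≈[ m ] U
  found⇒≈ {μ} found = ⊆-antisym μ⊆U U⊆μ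
    where
    μ-lub : T (upperBound m R S μ) × T (allL (λ ν → not (upperBound m R S ν) ∨ refines m μ ν) (NCP m))
    μ-lub = Equivalence.to T-∧ (proj₂ (findᵇ-just (isLeastUpperBound m R S) (NCP m) found))
    U⊆μ : U ⊆[ m ] μ
    U⊆μ = let R⊆μ , S⊆μ = upperBound⇒ {m} {R} {S} (proj₁ μ-lub) in
          least (proj₁ (findᵇ-just (isLeastUpperBound m R S) (NCP m) found)) R⊆μ S⊆μ
    μ⊆U : μ ⊆[ m ] U
    μ⊆U = ⊆-trans
      (refines⇒⊆ {m} {μ} (T-not∨⁻ (allL⁻ (proj₂ μ-lub) (representative∈NCP eqv nc)) representative-ub))
                  (≈⇒⊆ toPart-labels≈)

merge : Part → ℕ → ℕ → Part
merge R i j p q = R p q ∨ (R p i ∧ R j q) ∨ (R p j ∧ R i q)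

data Merged (R : Part) (i j p q : ℕ) : Set where
  unchanged : T (R p q) → Merged R i j p q
  via-ij    : T (R p i) → T (R j q) → Merged R i j p q
  via-ji    : T (R p j) → T (R i q) → Merged R i j p q

merged : ∀ R {i j p q} → T (merge R i j p q) → Merged R i j p q
merged R {i} {j} {p} {q} h with Equivalence.to (T-∨ {R p q}) h
... | inj₁ Rpq = unchanged Rpq
... | inj₂ h′ with Equivalence.to (T-∨ {R p i ∧ R j q}) h′
...   | inj₁ h″ = let Rpi , Rjq = Equivalence.to T-∧ h″ in via-ij Rpi Rjq
...   | inj₂ h″ = let Rpj , Riq = Equivalence.to T-∧ h″ in via-ji Rpj Riq

unchanged⁺ : ∀ R {i j p q} → T (R p q) → T (merge R i j p q)
unchanged⁺ R Rpq = Equivalence.from T-∨ (inj₁ Rpq)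

via-ij⁺ : ∀ R {i j p q} → T (R p i) → T (R j q) → T (merge R i j p q)
via-ij⁺ R {p = p} {q} Rpi Rjq =
  Equivalence.from (T-∨ {R p q}) (inj₂ (Equivalence.from T-∨ (inj₁ (Equivalence.from T-∧ (Rpi , Rjq)))))

via-ji⁺ : ∀ R {i j p q} → T (R p j) → T (R i q) → T (merge R i j p q)
via-ji⁺ R {i} {j} {p} {q} Rpj Riq =
  Equivalence.from (T-∨ {R p q})
    (inj₂ (Equivalence.from (T-∨ {R p i ∧ R j q}) (inj₂ (Equivalence.from T-∧ (Rpj , Riq)))))

module Merge {m R} (eqv : IsEquivalenceOn m R) {i j} (i<m : i < m) (j<m : j < m) where
  open IsEquivalenceOn eqv

  ⊆-merge : R ⊆[ m ] merge R i j
  ⊆-merge _ _ = unchanged⁺ R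

  merge-joins : T (merge R i j i j)
  merge-joins = via-ij⁺ R (reflexive i<m) (reflexive j<m)

  merge-isEquivalence : IsEquivalenceOn m (merge R i j)
  merge-isEquivalence = record
    { reflexive  = λ p<m → unchanged⁺ R (reflexive p<m)
    ; symmetric  = sym′
    ; transitive = trans′ }
    where
    sym′ : ∀ {p q} → p < m → q < m → T (merge R i j p q) → T (merge R i j q p)
    sym′ p<m q<m h with merged R h
    ... | unchanged Rpq = unchanged⁺ R (symmetric p<m q<m Rpq)
    ... | via-ij Rpi Rjq = via-ji⁺ R (symmetric j<m q<m Rjq) (symmetric p<m i<m Rpi)
    ... | via-ji Rpj Riq = via-ij⁺ R (symmetric i<m q<m Riq) (symmetric p<m j<m Rpj)
    trans′ : ∀ {p q r} → p < m → q < m → r < m →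
             T (merge R i j p q) → T (merge R i j q r) → T (merge R i j p r)
    trans′ p<m q<m r<m h g with merged R h | merged R g
    ... | unchanged Rpq  | unchanged Rqr  = unchanged⁺ R (transitive p<m q<m r<m Rpq Rqr)
    ... | unchanged Rpq  | via-ij Rqi Rjr = via-ij⁺ R (transitive p<m q<m i<m Rpq Rqi) Rjr
    ... | unchanged Rpq  | via-ji Rqj Rir = via-ji⁺ R (transitive p<m q<m j<m Rpq Rqj) Rir
    ... | via-ij Rpi Rjq | unchanged Rqr  = via-ij⁺ R Rpi (transitive j<m q<m r<m Rjq Rqr)
    ... | via-ij Rpi _   | via-ij _ Rjr   = via-ij⁺ R Rpi Rjr
    ... | via-ij Rpi _   | via-ji _ Rir   = unchanged⁺ R (transitive p<m i<m r<m Rpi Rir)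
    ... | via-ji Rpj Riq | unchanged Rqr  = via-ji⁺ R Rpj (transitive i<m q<m r<m Riq Rqr)
    ... | via-ji Rpj _   | via-ij _ Rjr   = unchanged⁺ R (transitive p<m j<m r<m Rpj Rjr)
    ... | via-ji Rpj _   | via-ji _ Rir   = via-ji⁺ R Rpj Rir

  merge-least : ∀ {F} → IsEquivalenceOn m F → R ⊆[ m ] F → T (F i j) → merge R i j ⊆[ m ] F
  merge-least eqF R⊆F Fij p<m q<m h with merged R h
  ... | unchanged Rpq  = R⊆F p<m q<m Rpq
  ... | via-ij Rpi Rjq = F.transitive p<m i<m q<m (R⊆F p<m i<m Rpi) (F.transitive i<m j<m q<m Fij (R⊆F j<m q<m Rjq))
    where module F = IsEquivalenceOn eqF
  ... | via-ji Rpj Riq = F.transitive p<m j<m q<m (R⊆F p<m j<m Rpj)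
                           (F.transitive j<m i<m q<m (F.symmetric i<m j<m Fij) (R⊆F i<m q<m Riq))
    where module F = IsEquivalenceOn eqF

Inside : ℕ → ℕ → ℕ → Set
Inside a c x = a < x × x < c

module _ {m R} (eqv : IsEquivalenceOn m R) (nc : NonCrossing m R) where
  open IsEquivalenceOn eqv

  inside-resp-block : ∀ {a c u t} → c < m → u < m → t < m → T (R a c) → ¬ T (R a u) → T (R u t) →
                 Inside a c u → Inside a c t
  inside-resp-block {a} {c} {u} {t} c<m u<m t<m Rac ¬Rau Rut (a<u , u<c) with <-cmp t a | <-cmp t c
  ... | tri< t<a _ _ | _ =
    ⊥-elim (¬Rau (transitive a<m t<m u<m (symmetric t<m a<m (nc t<a a<u u<c c<m Rtu Rac)) Rtu))
    where
    a<m = <-trans a<u u<m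
    Rtu = symmetric u<m t<m Rut
  ... | tri≈ _ refl _ | _ = ⊥-elim (¬Rau (symmetric u<m t<m Rut))
  ... | tri> _ _ a<t | tri< t<c _ _ = a<t , t<c
  ... | tri> _ _ a<t | tri≈ _ refl _ =
    ⊥-elim (¬Rau (transitive (<-trans a<u u<m) c<m u<m Rac (symmetric u<m c<m Rut)))
  ... | tri> _ _ a<t | tri> _ _ c<t = ⊥-elim (¬Rau (nc a<u u<c c<t t<m Rac Rut))

  module MergeAdjacent {i} (i+1<m : suc i < m) where

    i<m : i < m
    i<m = <-trans (n<1+n i) i+1<m

    inMerged : ℕ → Bool
    inMerged x = R x i ∨ R x (suc i)

    merged-adjacent : ∀ {p q} → p < m → q < m → T (merge R i (suc i) p q) →
                      T (R p q) ⊎ (T (inMerged p) × T (inMerged q))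
    merged-adjacent p<m q<m h with merged R h
    ... | unchanged Rpq  = inj₁ Rpq
    ... | via-ij Rpi Rjq = inj₂ (Equivalence.from T-∨ (inj₁ Rpi) , Equivalence.from T-∨ (inj₂ (symmetric i+1<m q<m Rjq)))
    ... | via-ji Rpj Riq = inj₂ (Equivalence.from T-∨ (inj₂ Rpj) , Equivalence.from T-∨ (inj₁ (symmetric i<m q<m Riq)))

    inMerged⇒merge : ∀ {p q} → p < m → q < m → T (inMerged p) → T (inMerged q) → T (merge R i (suc i) p q)
    inMerged⇒merge {p} {q} p<m q<m Up Uq with Equivalence.to (T-∨ {R p i}) Up | Equivalence.to (T-∨ {R q i}) Uq
    ... | inj₁ Rpi  | inj₁ Rqi  = unchanged⁺ R (transitive p<m i<m q<m Rpi (symmetric q<m i<m Rqi))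
    ... | inj₁ Rpi  | inj₂ Rqi′ = via-ij⁺ R Rpi (symmetric q<m i+1<m Rqi′)
    ... | inj₂ Rpi′ | inj₁ Rqi  = via-ji⁺ R Rpi′ (symmetric q<m i<m Rqi)
    ... | inj₂ Rpi′ | inj₂ Rqi′ = unchanged⁺ R (transitive p<m i+1<m q<m Rpi′ (symmetric q<m i+1<m Rqi′))

    -- i and i + 1 are adjacent, so a chord avoiding both blocks has them on the same side
    inMerged-inside : ∀ {a c u t} → c < m → u < m → t < m → T (R a c) → ¬ T (inMerged a) →
                      T (inMerged u) → T (inMerged t) → Inside a c u → Inside a c t
    inMerged-inside {a} {c} {u} {t} c<m u<m t<m Rac ¬Ua Uu Ut = fromBlock ∘ toBlock
      where
      ¬Rai : ¬ T (R a i)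
      ¬Rai = ¬Ua ∘ Equivalence.from T-∨ ∘ inj₁
      ¬Rai′ : ¬ T (R a (suc i))
      ¬Rai′ = ¬Ua ∘ Equivalence.from (T-∨ {R a i}) ∘ inj₂
      toBlock : Inside a c u → Inside a c i
      toBlock in-u with Equivalence.to (T-∨ {R u i}) Uu
      ... | inj₁ Rui = inside-resp-block c<m u<m i<m Rac (λ Rau → ¬Rai (transitive a<m u<m i<m Rau Rui)) Rui in-u
        where a<m = <-trans (proj₁ in-u) u<m
      ... | inj₂ Rui′
        with inside-resp-block c<m u<m i+1<m Rac (λ Rau → ¬Rai′ (transitive a<m u<m i+1<m Rau Rui′)) Rui′ in-u
        where a<m = <-trans (proj₁ in-u) u<m
      ...   | a<i+1 , i+1<c = ≤∧≢⇒< (≤-pred a<i+1) (λ { refl → ¬Rai (reflexive i<m) }) , <-trans (n<1+n i) i+1<c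
      fromBlock : Inside a c i → Inside a c t
      fromBlock (a<i , i<c) with Equivalence.to (T-∨ {R t i}) Ut
      ... | inj₁ Rti  = inside-resp-block c<m i<m t<m Rac ¬Rai (symmetric t<m i<m Rti) (a<i , i<c)
      ... | inj₂ Rti′ = inside-resp-block c<m i+1<m t<m Rac ¬Rai′ (symmetric t<m i+1<m Rti′)
                          (<-trans a<i (n<1+n i) , ≤∧≢⇒< i<c λ { refl → ¬Rai′ Rac })

    merge-nonCrossing : NonCrossing m (merge R i (suc i))
    merge-nonCrossing {a} {b} {c} {d} a<b b<c c<d d<m Mac Mbd =
      cases (merged-adjacent a<m c<m Mac) (merged-adjacent b<m d<m Mbd)
      where
      c<m = <-trans c<d d<m
      b<m = <-trans b<c c<m
      a<m = <-trans a<b b<m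
      cases : T (R a c) ⊎ (T (inMerged a) × T (inMerged c)) → T (R b d) ⊎ (T (inMerged b) × T (inMerged d)) →
              T (merge R i (suc i) a b)
      cases (inj₁ Rac)        (inj₁ Rbd)        = unchanged⁺ R (nc a<b b<c c<d d<m Rac Rbd)
      cases (inj₂ (Ua , _))   (inj₂ (Ub , _))   = inMerged⇒merge a<m b<m Ua Ub
      cases (inj₁ Rac)        (inj₂ (Ub , Ud)) with T? (inMerged a)
      ... | yes Ua = inMerged⇒merge a<m b<m Ua Ub
      ... | no ¬Ua = contradiction (proj₂ (inMerged-inside c<m b<m d<m Rac ¬Ua Ub Ud (a<b , b<c))) (<⇒≯ c<d)
      cases (inj₂ (Ua , Uc))  (inj₁ Rbd) with T? (inMerged b)
      ... | yes Ub = inMerged⇒merge a<m b<m Ua Ub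
      ... | no ¬Ub = contradiction (proj₁ (inMerged-inside d<m c<m a<m Rbd ¬Ub Uc Ua (b<c , c<d))) (<⇒≯ a<b)

mergePairs : Part → ℕ → Part
mergePairs R zero    = R
mergePairs R (suc k) = merge (mergePairs R k) (2 * k) (2 * k + 1)

module MergePairs {n R} (eqv : IsEquivalenceOn (2 * n) R) where

  mergePairs-isEquivalence : ∀ {k} → k ≤ n → IsEquivalenceOn (2 * n) (mergePairs R k)
  mergePairs-isEquivalence {zero}  _   = eqv
  mergePairs-isEquivalence {suc k} k<n =
    Merge.merge-isEquivalence (mergePairs-isEquivalence (<⇒≤ k<n)) (double-mono-< k<n) (double+1<double k<n)

  ⊆-mergePairs : ∀ {k} → k ≤ n → R ⊆[ 2 * n ] mergePairs R k
  ⊆-mergePairs {zero}  _   = ⊆-refl {R = R}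
  ⊆-mergePairs {suc k} k<n = ⊆-trans (⊆-mergePairs (<⇒≤ k<n))
    (Merge.⊆-merge (mergePairs-isEquivalence (<⇒≤ k<n)) (double-mono-< k<n) (double+1<double k<n))

  mergePairs-pairs : ∀ {k} → k ≤ n → ∀ {t} → t < k → T (mergePairs R k (2 * t) (2 * t + 1))
  mergePairs-pairs {suc k} k<n {t} t≤k with m≤n⇒m<n∨m≡n (≤-pred t≤k)
  ... | inj₁ t<k  = Merge.⊆-merge (mergePairs-isEquivalence (<⇒≤ k<n)) (double-mono-< k<n) (double+1<double k<n)
                      (double-mono-< (<-trans t<k k<n)) (double+1<double (<-trans t<k k<n))
                      (mergePairs-pairs (<⇒≤ k<n) t<k)
  ... | inj₂ refl = Merge.merge-joins (mergePairs-isEquivalence (<⇒≤ k<n)) (double-mono-< k<n) (double+1<double k<n)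

  mergePairs-least : ∀ {F} → IsEquivalenceOn (2 * n) F → R ⊆[ 2 * n ] F →
                     (∀ {t} → t < n → T (F (2 * t) (2 * t + 1))) → ∀ {k} → k ≤ n → mergePairs R k ⊆[ 2 * n ] F
  mergePairs-least eqF R⊆F pairs {zero}  _   = R⊆F
  mergePairs-least eqF R⊆F pairs {suc k} k<n =
    Merge.merge-least (mergePairs-isEquivalence (<⇒≤ k<n)) (double-mono-< k<n) (double+1<double k<n)
      eqF (mergePairs-least eqF R⊆F pairs (<⇒≤ k<n)) (pairs k<n)

  mergePairs-nonCrossing : NonCrossing (2 * n) R → ∀ {k} → k ≤ n → NonCrossing (2 * n) (mergePairs R k)
  mergePairs-nonCrossing nc {zero}  _   = nc
  mergePairs-nonCrossing nc {suc k} k<n =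
    subst (λ j → NonCrossing (2 * n) (merge (mergePairs R k) (2 * k) j)) (+-comm 1 (2 * k))
      (MergeAdjacent.merge-nonCrossing (mergePairs-isEquivalence (<⇒≤ k<n)) (mergePairs-nonCrossing nc (<⇒≤ k<n))
        (subst (_< 2 * n) (+-comm (2 * k) 1) (double+1<double k<n)))

half-< : ∀ {p n} → p < 2 * n → ⌊ p /2⌋ < n
half-< {p} p<2n with parity p
... | even x = subst (_< _) (sym (half-double x)) (double-cancel-< p<2n)
... | odd x  = subst (_< _) (sym (half-double+1 x)) (double+1<double⁻ p<2n)

pairClosure : ℕ → Part → Part → Part
pairClosure n α γ = mergePairs (star α γ) n

join : ℕ → Part → Part → Part
join n α γ i j = pairClosure n α γ (2 * i + 1) (2 * j + 1)

module _ {n α γ} (eqα : IsEquivalenceOn n α) (eqγ : IsEquivalenceOn n γ) where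
  private
    module A = IsEquivalenceOn eqα
    module G = IsEquivalenceOn eqγ

  star-isEquivalence : IsEquivalenceOn (2 * n) (star α γ)
  star-isEquivalence = record { reflexive = refl′ ; symmetric = sym′ ; transitive = trans′ }
    where
    refl′ : ∀ {p} → p < 2 * n → T (star α γ p p)
    refl′ {p} p<2n with parity p
    ... | even x = subst T (sym (star-even-even α γ x x)) (A.reflexive (double-cancel-< p<2n))
    ... | odd x  = subst T (sym (star-odd-odd α γ x x)) (G.reflexive (double+1<double⁻ p<2n))
    sym′ : ∀ {p q} → p < 2 * n → q < 2 * n → T (star α γ p q) → T (star α γ q p)
    sym′ {p} {q} p<2n q<2n Spq with parity p | parity q
    ... | even x | even y = subst T (sym (star-even-even α γ y x))
                              (A.symmetric (double-cancel-< p<2n) (double-cancel-< q<2n) (subst T (star-even-even α γ x y) Spq))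
    ... | odd x  | odd y  = subst T (sym (star-odd-odd α γ y x))
                              (G.symmetric (double+1<double⁻ p<2n) (double+1<double⁻ q<2n)
                                (subst T (star-odd-odd α γ x y) Spq))
    ... | even x | odd y  = ⊥-elim (subst T (star-even-odd α γ x y) Spq)
    ... | odd x  | even y = ⊥-elim (subst T (star-odd-even α γ x y) Spq)
    trans′ : ∀ {p q r} → p < 2 * n → q < 2 * n → r < 2 * n →
             T (star α γ p q) → T (star α γ q r) → T (star α γ p r)
    trans′ {p} {q} {r} p<2n q<2n r<2n Spq Sqr with parity p | parity q | parity r
    ... | even x | even y | even z = subst T (sym (star-even-even α γ x z))
      (A.transitive (double-cancel-< p<2n) (double-cancel-< q<2n) (double-cancel-< r<2n)
        (subst T (star-even-even α γ x y) Spq) (subst T (star-even-even α γ y z) Sqr))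
    ... | odd x  | odd y  | odd z  = subst T (sym (star-odd-odd α γ x z))
      (G.transitive (double+1<double⁻ p<2n) (double+1<double⁻ q<2n) (double+1<double⁻ r<2n)
        (subst T (star-odd-odd α γ x y) Spq) (subst T (star-odd-odd α γ y z) Sqr))
    ... | even x | odd y  | _      = ⊥-elim (subst T (star-even-odd α γ x y) Spq)
    ... | odd x  | even y | _      = ⊥-elim (subst T (star-odd-even α γ x y) Spq)
    ... | _      | even y | odd z  = ⊥-elim (subst T (star-even-odd α γ y z) Sqr)
    ... | _      | odd y  | even z = ⊥-elim (subst T (star-odd-even α γ y z) Sqr)

  open MergePairs {n} star-isEquivalence

  pairClosure-isEquivalence : IsEquivalenceOn (2 * n) (pairClosure n α γ)
  pairClosure-isEquivalence = mergePairs-isEquivalence ≤-refl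

  private
    module C = IsEquivalenceOn pairClosure-isEquivalence

  join-isEquivalence : IsEquivalenceOn n (join n α γ)
  join-isEquivalence = record
    { reflexive  = λ i<n → C.reflexive (double+1<double i<n)
    ; symmetric  = λ i<n j<n → C.symmetric (double+1<double i<n) (double+1<double j<n)
    ; transitive = λ i<n j<n k<n → C.transitive (double+1<double i<n) (double+1<double j<n) (double+1<double k<n) }

  ⊆-joinˡ : α ⊆[ n ] join n α γ
  ⊆-joinˡ {x} {y} x<n y<n αxy =
    C.transitive (double+1<double x<n) (double-mono-< x<n) (double+1<double y<n)
      (C.symmetric (double-mono-< x<n) (double+1<double x<n) (mergePairs-pairs ≤-refl x<n))
      (C.transitive (double-mono-< x<n) (double-mono-< y<n) (double+1<double y<n)
        (⊆-mergePairs ≤-refl (double-mono-< x<n) (double-mono-< y<n) (subst T (sym (star-even-even α γ x y)) αxy))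
        (mergePairs-pairs ≤-refl y<n))

  ⊆-joinʳ : γ ⊆[ n ] join n α γ
  ⊆-joinʳ {x} {y} x<n y<n γxy =
    ⊆-mergePairs ≤-refl (double+1<double x<n) (double+1<double y<n) (subst T (sym (star-odd-odd α γ x y)) γxy)

  join-least : ∀ {F} → IsEquivalenceOn n F → α ⊆[ n ] F → γ ⊆[ n ] F → join n α γ ⊆[ n ] F
  join-least {F} eqF α⊆F γ⊆F {i} {j} i<n j<n h =
    subst₂ (λ x y → T (F x y)) (half-double+1 i) (half-double+1 j)
      (mergePairs-least halved-isEquivalence star⊆halved pairs-halved ≤-refl (double+1<double i<n) (double+1<double j<n) h)
    where
    module F = IsEquivalenceOn eqF
    halved : Part
    halved p q = F ⌊ p /2⌋ ⌊ q /2⌋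
    halved-isEquivalence : IsEquivalenceOn (2 * n) halved
    halved-isEquivalence = record
      { reflexive  = λ p<2n → F.reflexive (half-< p<2n)
      ; symmetric  = λ p<2n q<2n → F.symmetric (half-< p<2n) (half-< q<2n)
      ; transitive = λ p<2n q<2n r<2n → F.transitive (half-< p<2n) (half-< q<2n) (half-< r<2n) }
    star⊆halved : star α γ ⊆[ 2 * n ] halved
    star⊆halved {p} {q} p<2n q<2n Spq with parity p | parity q
    ... | even x | even y = subst₂ (λ x y → T (F x y)) (sym (half-double x)) (sym (half-double y))
                              (α⊆F (double-cancel-< p<2n) (double-cancel-< q<2n) (subst T (star-even-even α γ x y) Spq))
    ... | odd x  | odd y  = subst₂ (λ x y → T (F x y)) (sym (half-double+1 x)) (sym (half-double+1 y))
                              (γ⊆F (double+1<double⁻ p<2n) (double+1<double⁻ q<2n) (subst T (star-odd-odd α γ x y) Spq))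
    ... | even x | odd y  = ⊥-elim (subst T (star-even-odd α γ x y) Spq)
    ... | odd x  | even y = ⊥-elim (subst T (star-odd-even α γ x y) Spq)
    pairs-halved : ∀ {t} → t < n → T (halved (2 * t) (2 * t + 1))
    pairs-halved {t} t<n = subst₂ (λ x y → T (F x y)) (sym (half-double t)) (sym (half-double+1 t)) (F.reflexive t<n)

  pairs⊆pairClosure : pairsP ⊆[ 2 * n ] pairClosure n α γ
  pairs⊆pairClosure {p} {q} p<2n q<2n same with parity p | parity q | ≡ᵇ⇒≡ ⌊ p /2⌋ ⌊ q /2⌋ same
  ... | even x | even y | eq with trans (sym (half-double x)) (trans eq (half-double y))
  ...   | refl = C.reflexive p<2n
  pairs⊆pairClosure p<2n q<2n same | odd x | odd y | eq with trans (sym (half-double+1 x)) (trans eq (half-double+1 y))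
  ...   | refl = C.reflexive p<2n
  pairs⊆pairClosure p<2n q<2n same | even x | odd y | eq with trans (sym (half-double x)) (trans eq (half-double+1 y))
  ...   | refl = mergePairs-pairs ≤-refl {x} (double-cancel-< p<2n)
  pairs⊆pairClosure p<2n q<2n same | odd x | even y | eq with trans (sym (half-double+1 x)) (trans eq (half-double y))
  ...   | refl = C.symmetric q<2n p<2n (mergePairs-pairs ≤-refl {y} (double-cancel-< q<2n))

  pairClosure-least : ∀ {F} → IsEquivalenceOn (2 * n) F → star α γ ⊆[ 2 * n ] F → pairsP ⊆[ 2 * n ] F →
                      pairClosure n α γ ⊆[ 2 * n ] F
  pairClosure-least eqF star⊆F pairs⊆F = mergePairs-least eqF star⊆F
    (λ {t} t<n → pairs⊆F (double-mono-< t<n) (double+1<double t<n)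
                   (≡⇒≡ᵇ ⌊ 2 * t /2⌋ _ (trans (half-double t) (sym (half-double+1 t)))))
    ≤-refl

  module _ (adm : T (admissible n α γ)) where

    pairClosure-nonCrossing : NonCrossing (2 * n) (pairClosure n α γ)
    pairClosure-nonCrossing = mergePairs-nonCrossing (admissible⇒starNonCrossing {n} {α} {γ} adm) ≤-refl

    join-nonCrossing : NonCrossing n (join n α γ)
    join-nonCrossing a<b b<c c<d d<n =
      pairClosure-nonCrossing (double+1-mono-< a<b) (double+1-mono-< b<c) (double+1-mono-< c<d) (double+1<double d<n)

    circ≈join : circ n α γ ≈[ n ] join n α γ
    circ≈join i<n j<n =
      joinNC-≈ pairClosure-isEquivalence pairClosure-nonCrossing
        (⊆-mergePairs ≤-refl) pairs⊆pairClosure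
        (λ ν∈ → pairClosure-least (∈NCP⇒isEquivalence ν∈))
        (double+1<double i<n) (double+1<double j<n)

kernel : (ℕ → Bool) → Part
kernel S p q = Relation.Nullary.Decidable.⌊ S p ≟ S q ⌋

kernel-isEquivalence : ∀ {n} S → IsEquivalenceOn n (kernel S)
kernel-isEquivalence S = record
  { reflexive  = λ _ → fromWitness refl
  ; symmetric  = λ _ _ → fromWitness ∘ sym ∘ toWitness
  ; transitive = λ _ _ _ Spq Sqr → fromWitness (trans (toWitness Spq) (toWitness Sqr)) }

saturated⇒⊆kernel : ∀ {n R S} → Saturated n R S → R ⊆[ n ] kernel S
saturated⇒⊆kernel sat u<n v<n = fromWitness ∘ sat u<n v<n

⊆kernel⇒saturated : ∀ {n R S} → R ⊆[ n ] kernel S → Saturated n R S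
⊆kernel⇒saturated R⊆ker u<n v<n = toWitness ∘ R⊆ker u<n v<n

module _ {n α γ} (eqα : IsEquivalenceOn n α) (eqγ : IsEquivalenceOn n γ) where

  saturated-join : ∀ {S} → Saturated n α S → Saturated n γ S → Saturated n (join n α γ) S
  saturated-join {S} satα satγ = ⊆kernel⇒saturated
    (join-least eqα eqγ (kernel-isEquivalence S) (saturated⇒⊆kernel satα) (saturated⇒⊆kernel satγ))

  compatible-joinˡ : ∀ {δ} → Compatible n α δ → Compatible n γ δ → Compatible n (join n α γ) δ
  compatible-joinˡ compα compγ y<n w<n δyw = saturated-join (compα y<n w<n δyw) (compγ y<n w<n δyw)

  compatible-joinʳ : ∀ {δ} → Compatible n δ α → Compatible n δ γ → Compatible n δ (join n α γ)
  compatible-joinʳ compα compγ = saturatedᵅ⇒compatible λ u<n v<n δuv →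
    saturated-join (compatible⇒saturatedᵅ compα u<n v<n δuv) (compatible⇒saturatedᵅ compγ u<n v<n δuv)

join-cong : ∀ {n α α′ γ γ′} → IsEquivalenceOn n α → IsEquivalenceOn n α′ → IsEquivalenceOn n γ → IsEquivalenceOn n γ′ →
            α ≈[ n ] α′ → γ ≈[ n ] γ′ → join n α γ ≈[ n ] join n α′ γ′
join-cong eqα eqα′ eqγ eqγ′ α≈α′ γ≈γ′ = ⊆-antisym
  (join-least eqα eqγ (join-isEquivalence eqα′ eqγ′)
    (⊆-trans (≈⇒⊆ α≈α′) (⊆-joinˡ eqα′ eqγ′)) (⊆-trans (≈⇒⊆ γ≈γ′) (⊆-joinʳ eqα′ eqγ′)))
  (join-least eqα′ eqγ′ (join-isEquivalence eqα eqγ)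
    (⊆-trans (≈⇒⊇ α≈α′) (⊆-joinˡ eqα eqγ)) (⊆-trans (≈⇒⊇ γ≈γ′) (⊆-joinʳ eqα eqγ)))

join-congʳ : ∀ {n α γ γ′} → IsEquivalenceOn n α → IsEquivalenceOn n γ → IsEquivalenceOn n γ′ →
             γ ≈[ n ] γ′ → join n α γ ≈[ n ] join n α γ′
join-congʳ {α = α} eqα eqγ eqγ′ = join-cong eqα eqα eqγ eqγ′ (≈-refl {R = α})

join-assoc : ∀ {n α β γ} → IsEquivalenceOn n α → IsEquivalenceOn n β → IsEquivalenceOn n γ →
             join n (join n α β) γ ≈[ n ] join n α (join n β γ)
join-assoc {n} {α} {β} {γ} eqα eqβ eqγ = ⊆-antisym
  (join-least eqαβ eqγ eqα[βγ]
    (join-least eqα eqβ eqα[βγ] (⊆-joinˡ eqα eqβγ) (⊆-trans (⊆-joinˡ eqβ eqγ) (⊆-joinʳ eqα eqβγ)))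
    (⊆-trans (⊆-joinʳ eqβ eqγ) (⊆-joinʳ eqα eqβγ)))
  (join-least eqα eqβγ eq[αβ]γ
    (⊆-trans (⊆-joinˡ eqα eqβ) (⊆-joinˡ eqαβ eqγ))
    (join-least eqβ eqγ eq[αβ]γ (⊆-trans (⊆-joinʳ eqα eqβ) (⊆-joinˡ eqαβ eqγ)) (⊆-joinʳ eqαβ eqγ)))
  where
  eqαβ = join-isEquivalence eqα eqβ
  eqβγ = join-isEquivalence eqβ eqγ
  eq[αβ]γ = join-isEquivalence eqαβ eqγ
  eqα[βγ] = join-isEquivalence eqα eqβγ

zeroP-isEquivalence : ∀ {n} → IsEquivalenceOn n zeroP
zeroP-isEquivalence = record
  { reflexive  = λ {i} _ → ≡⇒≡ᵇ i i refl
  ; symmetric  = λ {i} {j} _ _ ij → ≡⇒≡ᵇ j i (sym (≡ᵇ⇒≡ i j ij))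
  ; transitive = λ {i} {j} {k} _ _ _ ij jk → ≡⇒≡ᵇ i k (trans (≡ᵇ⇒≡ i j ij) (≡ᵇ⇒≡ j k jk)) }

zeroP-nonCrossing : ∀ {n} → NonCrossing n zeroP
zeroP-nonCrossing {a = a} {b} {c} a<b b<c _ _ ac with ≡ᵇ⇒≡ a c ac
... | refl = ⊥-elim (<-irrefl refl (<-trans a<b b<c))

join-zeroʳ : ∀ {n α} → IsEquivalenceOn n α → join n α zeroP ≈[ n ] α
join-zeroʳ {n} {α} eqα = ⊆-antisym
  (join-least eqα zeroP-isEquivalence eqα (⊆-refl {R = α}) zero⊆α)
  (⊆-joinˡ eqα zeroP-isEquivalence)
  where
  zero⊆α : zeroP ⊆[ n ] α
  zero⊆α {i} {j} i<n _ ij with ≡ᵇ⇒≡ i j ij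
  ... | refl = IsEquivalenceOn.reflexive eqα i<n

-- The relative Kreweras complement

openInterval : ℕ → ℕ → ℕ → Bool
openInterval p q x = (p <ᵇ x) ∧ (x <ᵇ q)

closedInterval : ℕ → ℕ → ℕ → Bool
closedInterval lo hi x = not (x <ᵇ lo) ∧ not (hi <ᵇ x)

openInterval⁺ : ∀ {p q x} → p < x → x < q → T (openInterval p q x)
openInterval⁺ p<x x<q = Equivalence.from T-∧ (<⇒<ᵇ p<x , <⇒<ᵇ x<q)

openInterval⁻ : ∀ {p q x} → T (openInterval p q x) → p < x × x < q
openInterval⁻ {p} {q} {x} h with Equivalence.to (T-∧ {p <ᵇ x}) h
... | p<x , x<q = <ᵇ⇒< p x p<x , <ᵇ⇒< x q x<q

closedInterval⁺ : ∀ {lo hi x} → lo ≤ x → x ≤ hi → T (closedInterval lo hi x)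
closedInterval⁺ lo≤x x≤hi = Equivalence.from T-∧
  (Equivalence.from T-not-≡ (≥⇒<ᵇ≡false lo≤x) , Equivalence.from T-not-≡ (≥⇒<ᵇ≡false x≤hi))

closedInterval⁻ : ∀ {lo hi x} → T (closedInterval lo hi x) → lo ≤ x × x ≤ hi
closedInterval⁻ {lo} {hi} {x} h with Equivalence.to (T-∧ {not (x <ᵇ lo)}) h
... | x≮lo , hi≮x =
  <ᵇ≡false⇒≥ {x} {lo} (Equivalence.to T-not-≡ x≮lo) , <ᵇ≡false⇒≥ {hi} {x} (Equivalence.to T-not-≡ hi≮x)

insideγ⁺ : ∀ {y w p} → y < p → p ≤ w → T (insideγ y w p)
insideγ⁺ y<p p≤w rewrite <⇒<ᵇ≡true y<p | ≥⇒<ᵇ≡false p≤w = _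

insideγ-split : ∀ {b w M} → b < w → w ≤ M → ∀ x → insideγ b M x ≡ openInterval b w x ∨ closedInterval w M x
insideγ-split {b} {w} {M} b<w w≤M x = T-ext split unsplit
  where
  split : T (insideγ b M x) → T (openInterval b w x ∨ closedInterval w M x)
  split inside with insideγ-true (<⇒≤ (<-≤-trans b<w w≤M)) inside | x <? w
  ... | b<x , _   | yes x<w = Equivalence.from T-∨ (inj₁ (openInterval⁺ b<x x<w))
  ... | _   , x≤M | no  x≮w = Equivalence.from T-∨ (inj₂ (closedInterval⁺ (≮⇒≥ x≮w) x≤M))
  unsplit : T (openInterval b w x ∨ closedInterval w M x) → T (insideγ b M x)
  unsplit h with Equivalence.to (T-∨ {openInterval b w x}) h
  ... | inj₁ open′  = let b<x , x<w = openInterval⁻ open′ in insideγ⁺ b<x (<⇒≤ (<-≤-trans x<w w≤M))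
  ... | inj₂ closed = let w≤x , x≤M = closedInterval⁻ closed in insideγ⁺ (<-≤-trans b<w w≤x) x≤M

insideγ-below : ∀ {y w p} → p ≤ y → p ≤ w → insideγ y w p ≡ false
insideγ-below p≤y p≤w rewrite ≥⇒<ᵇ≡false p≤y | ≥⇒<ᵇ≡false p≤w = refl

insideγ-self : ∀ y p → insideγ y y p ≡ false
insideγ-self y p = xor-same (y <ᵇ p)

insideγ-trans : ∀ y v w p → insideγ y w p ≡ insideγ y v p xor insideγ v w p
insideγ-trans y v w p with y <ᵇ p | v <ᵇ p | w <ᵇ p
... | false | false | c = refl
... | false | true  | false = refl
... | false | true  | true  = refl
... | true  | false | c = refl
... | true  | true  | false = refl
... | true  | true  | true  = refl

insideγ-nested : ∀ {y z w v} → y < z → z < w → w < v → ∀ p →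
                 insideγ y z p ≡ insideγ y w p ∧ not (insideγ z v p)
insideγ-nested {y} {z} {w} {v} y<z z<w w<v p = T-ext narrow widen
  where
  narrow : T (insideγ y z p) → T (insideγ y w p ∧ not (insideγ z v p))
  narrow inside with insideγ-true {p = p} (<⇒≤ y<z) inside
  ... | y<p , p≤z = Equivalence.from (T-∧ {insideγ y w p})
    ( insideγ⁺ y<p (≤-trans p≤z (<⇒≤ z<w))
    , Equivalence.from T-not-≡ (insideγ-below p≤z (≤-trans p≤z (<⇒≤ (<-trans z<w w<v)))) )
  widen : T (insideγ y w p ∧ not (insideγ z v p)) → T (insideγ y z p)
  widen h with Equivalence.to (T-∧ {insideγ y w p}) h
  ... | inYW , notZV with insideγ-true (<⇒≤ (<-trans y<z z<w)) inYW | insideγ-false {z} {v} {p} (T-not⇒¬T notZV)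
  ...   | y<p , p≤w | inj₁ p≤z = insideγ⁺ y<p p≤z
  ...   | y<p , p≤w | inj₂ v<p = contradiction (≤-<-trans p≤w (<-trans w<v v<p)) (<-irrefl refl)

module _ {n R} (eqv : IsEquivalenceOn n R) (nc : NonCrossing n R) where
  open IsEquivalenceOn eqv

  blockSpan-saturated : ∀ {h lo hi} → h < n → lo < n → hi < n → T (R h lo) → T (R h hi) →
                        (∀ {x} → x < n → T (R h x) → lo ≤ x × x ≤ hi) → Saturated n R (closedInterval lo hi)
  blockSpan-saturated {h} {lo} {hi} h<n lo<n hi<n Rhlo Rhhi span = saturated-by-implication eqv stays
    where
    stays : ∀ {u v} → u < n → v < n → T (R u v) → T (closedInterval lo hi u) → T (closedInterval lo hi v)
    stays {u} {v} u<n v<n Ruv u∈ with T? (R h u)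
    ... | yes Rhu = let lo≤v , v≤hi = span v<n (transitive h<n u<n v<n Rhu Ruv) in closedInterval⁺ lo≤v v≤hi
    ... | no ¬Rhu =
      let lo≤u , u≤hi = closedInterval⁻ u∈
          lo<v , v<hi = inside-resp-block eqv nc hi<n u<n v<n
                          (transitive lo<n h<n hi<n (symmetric h<n lo<n Rhlo) Rhhi)
                          (λ Rlou → ¬Rhu (transitive h<n lo<n u<n Rhlo Rlou))
                          Ruv
                          ( ≤∧≢⇒< lo≤u (λ { refl → ¬Rhu Rhlo })
                          , ≤∧≢⇒< u≤hi (λ { refl → ¬Rhu Rhhi }))
      in closedInterval⁺ (<⇒≤ lo<v) (<⇒≤ v<hi)

  gap-saturated : ∀ {p q} → p < q → q < n → T (R p q) → (∀ {x} → p < x → x < q → ¬ T (R x q)) →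
                  Saturated n R (openInterval p q)
  gap-saturated {p} {q} p<q q<n Rpq gap = saturated-by-implication eqv stays
    where
    stays : ∀ {u v} → u < n → v < n → T (R u v) → T (openInterval p q u) → T (openInterval p q v)
    stays {u} {v} u<n v<n Ruv u∈ =
      let p<u , u<q = openInterval⁻ u∈
          p<v , v<q = inside-resp-block eqv nc q<n u<n v<n Rpq
                        (λ Rpu → gap p<u u<q (transitive u<n (<-trans p<q q<n) q<n (symmetric (<-trans p<q q<n) u<n Rpu) Rpq))
                        Ruv (p<u , u<q)
      in openInterval⁺ p<v v<q

record IsRelKreweras (n : ℕ) (α β γ : Part) : Set where
  field
    isEquivalence : IsEquivalenceOn n γ
    isNonCrossing : NonCrossing n γ
    compatible    : Compatible n α γ
    join≈         : join n α γ ≈[ n ] β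

-- y and w share a block of K_β(α) iff they share a block of β and
-- the points of α lying between y′ and w′ form a union of blocks of α
explicitKreweras : ℕ → Part → Part → Part
explicitKreweras n α β y w = β y w ∧ refines n α (kernel (insideγ y w))

module ExplicitKreweras {n α β} (eqα : IsEquivalenceOn n α) (eqβ : IsEquivalenceOn n β) (ncβ : NonCrossing n β) where
  private
    module A = IsEquivalenceOn eqα
    module B = IsEquivalenceOn eqβ

  κ : Part
  κ = explicitKreweras n α β

  κ⁺ : ∀ {y w} → T (β y w) → Saturated n α (insideγ y w) → T (κ y w)
  κ⁺ βyw sat = Equivalence.from T-∧ (βyw , ⊆⇒refines (saturated⇒⊆kernel sat))

  κ⊆β : κ ⊆[ n ] β
  κ⊆β {y} _ _ κyw = proj₁ (Equivalence.to (T-∧ {β y _}) κyw)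

  κ-saturated : ∀ {y w} → T (κ y w) → Saturated n α (insideγ y w)
  κ-saturated {y} {w} κyw =
    ⊆kernel⇒saturated (refines⇒⊆ {n} {α} (proj₂ (Equivalence.to (T-∧ {β y w}) κyw)))

  κ-compatible : Compatible n α κ
  κ-compatible _ _ = κ-saturated

  κ-isEquivalence : IsEquivalenceOn n κ
  κ-isEquivalence = record
    { reflexive  = λ {i} i<n → κ⁺ (B.reflexive i<n)
                     (saturated-≗ {R = α} (λ p → sym (insideγ-self i p)) λ _ _ _ → refl)
    ; symmetric  = λ {i} {j} i<n j<n κij → κ⁺ (B.symmetric i<n j<n (κ⊆β i<n j<n κij))
                     (saturated-≗ (insideγ-comm i j) (κ-saturated κij))
    ; transitive = λ {i} {j} {k} i<n j<n k<n κij κjk →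
                     κ⁺ (B.transitive i<n j<n k<n (κ⊆β i<n j<n κij) (κ⊆β j<n k<n κjk))
                        (saturated-≗ (λ p → sym (insideγ-trans i j k p))
                          (saturated-op _xor_ (κ-saturated κij) (κ-saturated κjk))) }

  κ-nonCrossing : NonCrossing n κ
  κ-nonCrossing y<z z<w w<v v<n κyw κzv =
    κ⁺ (ncβ y<z z<w w<v v<n (κ⊆β y<n w<n κyw) (κ⊆β z<n v<n κzv))
       (saturated-≗ (λ p → sym (insideγ-nested y<z z<w w<v p))
         (saturated-op (λ a b → a ∧ not b) (κ-saturated κyw) (κ-saturated κzv)))
    where
    w<n = <-trans w<v v<n
    z<n = <-trans z<w w<n
    y<n = <-trans y<z z<n

  module Existence (ncα : NonCrossing n α) (α⊆β : α ⊆[ n ] β) where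
    open Canonical eqα using (blockMin-<; blockMin-≤; blockMin-related)
    private
      module J = IsEquivalenceOn (join-isEquivalence eqα κ-isEquivalence)

    BelowIn : ℕ → Set
    BelowIn w = w < n → ∀ {y} → y < w → T (β y w) → T (join n α κ y w)

    β-below⊆join : ∀ w → BelowIn w
    β-below⊆join = <-rec BelowIn step
      where
      step : ∀ w → (∀ {w′} → w′ < w → BelowIn w′) → BelowIn w
      step w ih w<n {y} y<w βyw = case m≤n⇒m<n∨m≡n (blockMin-≤ w<n) of λ where
          (inj₁ a₀<w) → viaBlockMin a₀<w (<-cmp y (blockMin n α w))
          (inj₂ a₀≡w) → viaPredecessor a₀≡w
        where
        y<n = <-trans y<w w<n
        -- w is linked to the least point a₀ of its α-block, and y to a₀ by induction
        viaBlockMin : blockMin n α w < w → Tri (y < blockMin n α w) (y ≡ blockMin n α w) (blockMin n α w < y) →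
                      T (join n α κ y w)
        viaBlockMin a₀<w y⋚a₀ = link y⋚a₀
          where
          a₀<n = blockMin-< w<n
          αwa₀ = blockMin-related w<n
          βya₀ = B.transitive y<n w<n a₀<n βyw (α⊆β w<n a₀<n αwa₀)
          Ja₀w = ⊆-joinˡ eqα κ-isEquivalence a₀<n w<n (A.symmetric w<n a₀<n αwa₀)
          link : Tri (y < blockMin n α w) (y ≡ blockMin n α w) (blockMin n α w < y) → T (join n α κ y w)
          link (tri< y<a₀ _ _) = J.transitive y<n a₀<n w<n (ih a₀<w a₀<n y<a₀ βya₀) Ja₀w
          link (tri≈ _ y≡a₀ _) = subst (λ x → T (join n α κ x w)) (sym y≡a₀) Ja₀w
          link (tri> _ _ a₀<y) =
            J.transitive y<n a₀<n w<n (J.symmetric a₀<n y<n (ih y<w y<n a₀<y (B.symmetric y<n a₀<n βya₀))) Ja₀w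
        -- w is the least point of its α-block [w, M]; its β-predecessor b then satisfies κ b M
        viaPredecessor : blockMin n α w ≡ w → T (join n α κ y w)
        viaPredecessor a₀≡w = fromPredecessor (m≤n⇒m<n∨m≡n y≤b)
          where
          open GreatestBelow (greatestBelow (λ x → β x w) w βyw y<w)
            renaming (value to b; ≥j to y≤b; <k to b<w; holds to βbw; maximal to gap)
          open GreatestBelow (greatestBelow (α w) n (A.reflexive w<n) w<n)
            renaming (value to M; ≥j to w≤M; <k to M<n; holds to αwM; maximal to afterM)
          b<n = <-trans b<w w<n
          span : ∀ {x} → x < n → T (α w x) → w ≤ x × x ≤ M
          span x<n αwx = subst (_≤ _) a₀≡w (first-≤ (α w) n αwx) , ≮⇒≥ (λ M<x → afterM M<x x<n αwx)
          κbM : T (κ b M)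
          κbM = κ⁺ (B.transitive b<n w<n M<n βbw (α⊆β w<n M<n αwM))
            (saturated-≗ (λ x → sym (insideγ-split b<w w≤M x))
              (saturated-op _∨_ (saturated-antitone α⊆β (gap-saturated eqβ ncβ b<w w<n βbw gap))
                                (blockSpan-saturated eqα ncα w<n w<n M<n (A.reflexive w<n) αwM span)))
          Jbw : T (join n α κ b w)
          Jbw = J.transitive b<n M<n w<n (⊆-joinʳ eqα κ-isEquivalence b<n M<n κbM)
                  (⊆-joinˡ eqα κ-isEquivalence M<n w<n (A.symmetric w<n M<n αwM))
          fromPredecessor : y < b ⊎ y ≡ b → T (join n α κ y w)
          fromPredecessor (inj₁ y<b) =
            J.transitive y<n b<n w<n (ih b<w b<n y<b (B.transitive y<n w<n b<n βyw (B.symmetric b<n w<n βbw))) Jbw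
          fromPredecessor (inj₂ y≡b) = subst (λ x → T (join n α κ x w)) (sym y≡b) Jbw

    β⊆join : β ⊆[ n ] join n α κ
    β⊆join {y} {w} y<n w<n βyw with <-cmp y w
    ... | tri< y<w _ _  = β-below⊆join w w<n y<w βyw
    ... | tri≈ _ refl _ = J.reflexive y<n
    ... | tri> _ _ w<y  = J.symmetric w<n y<n (β-below⊆join y y<n w<y (B.symmetric y<n w<n βyw))

    join≈β : join n α κ ≈[ n ] β
    join≈β = ⊆-antisym (join-least eqα κ-isEquivalence eqβ α⊆β κ⊆β) β⊆join

    κ-isRelKreweras : IsRelKreweras n α β κ
    κ-isRelKreweras = record
      { isEquivalence = κ-isEquivalence ; isNonCrossing = κ-nonCrossing ; compatible = κ-compatible ; join≈ = join≈β }

  module Uniqueness {γ} (rel : IsRelKreweras n α β γ) where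
    open IsRelKreweras rel
    private
      module G = IsEquivalenceOn isEquivalence
      module K = IsEquivalenceOn κ-isEquivalence
    open Canonical isEquivalence using () renaming (blockMin-< to γ-min<; blockMin-related to γ-min-related)
    open Canonical κ-isEquivalence using () renaming (blockMin-< to κ-min<; blockMin-related to κ-min-related)

    γ⊆κ : γ ⊆[ n ] κ
    γ⊆κ y<n w<n γyw = κ⁺ (≈⇒⊆ join≈ y<n w<n (⊆-joinʳ eqα isEquivalence y<n w<n γyw)) (compatible y<n w<n γyw)

    -- If the least point d of the κ-block of y were smaller than the least point m of the γ-block
    -- of some h in it, then with p the κ-predecessor of m and M the last point of the γ-block of h,
    -- the interval from p to M would be saturated for α and γ, hence for β, though β p m.
    κ-block⊆γ-block : ∀ {y h} → y < n → h < n → T (κ y h) → T (γ h (blockMin n κ y))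
    κ-block⊆γ-block {y} {h} y<n h<n κyh with m≤n⇒m<n∨m≡n (first-≤ (κ y) n κym)
      where
      κym = K.transitive y<n h<n (γ-min< h<n) κyh (γ⊆κ h<n (γ-min< h<n) (γ-min-related h<n))
    ... | inj₂ d≡m = subst (λ x → T (γ h x)) (sym d≡m) (γ-min-related h<n)
    ... | inj₁ d<m = contradiction (β-saturated p<n m<n (κ⊆β p<n m<n κpm))
                       (λ eq → subst T (trans (sym eq) (insideγ-below ≤-refl (<⇒≤ (<-≤-trans p<m m≤M))))
                                     (insideγ⁺ p<m m≤M))
      where
      m = blockMin n γ h
      m<n = γ-min< h<n
      γhm = γ-min-related h<n
      d<n = κ-min< y<n
      κym = K.transitive y<n h<n m<n κyh (γ⊆κ h<n m<n γhm)
      κdm = K.transitive d<n y<n m<n (K.symmetric y<n d<n (κ-min-related y<n)) κym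
      open GreatestBelow (greatestBelow (λ x → κ x m) m κdm d<m)
        using () renaming (value to p; <k to p<m; holds to κpm; maximal to gap)
      open GreatestBelow (greatestBelow (γ h) n (G.reflexive h<n) h<n)
        renaming (value to M; ≥j to h≤M; <k to M<n; holds to γhM; maximal to afterM)
      p<n = <-trans p<m m<n
      m≤M = ≤-trans (first-≤ (γ h) n (G.reflexive h<n)) h≤M
      span : ∀ {x} → x < n → T (γ h x) → m ≤ x × x ≤ M
      span x<n γhx = first-≤ (γ h) n γhx , ≮⇒≥ (λ M<x → afterM M<x x<n γhx)
      γ-saturated : Saturated n γ (insideγ p M)
      γ-saturated = saturated-≗ (λ x → sym (insideγ-split p<m m≤M x))
        (saturated-op _∨_ (saturated-antitone γ⊆κ (gap-saturated κ-isEquivalence κ-nonCrossing p<m m<n κpm gap))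
                          (blockSpan-saturated isEquivalence isNonCrossing h<n m<n M<n γhm γhM span))
      κpM = K.transitive p<n m<n M<n κpm (γ⊆κ m<n M<n (G.transitive m<n h<n M<n (G.symmetric h<n m<n γhm) γhM))
      β-saturated : Saturated n β (insideγ p M)
      β-saturated = saturated-antitone (≈⇒⊇ join≈) (saturated-join eqα isEquivalence (κ-saturated κpM) γ-saturated)

    κ⊆γ : κ ⊆[ n ] γ
    κ⊆γ y<n w<n κyw = G.transitive y<n (κ-min< y<n) w<n
      (κ-block⊆γ-block y<n y<n (K.reflexive y<n))
      (G.symmetric w<n (κ-min< y<n) (κ-block⊆γ-block y<n w<n κyw))

    ≈κ : γ ≈[ n ] κ
    ≈κ = ⊆-antisym γ⊆κ κ⊆γ

isRelKreweras-resp-≈ : ∀ {n α β γ γ′} → IsEquivalenceOn n α → IsEquivalenceOn n γ′ → γ ≈[ n ] γ′ →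
                       IsRelKreweras n α β γ → IsRelKreweras n α β γ′
isRelKreweras-resp-≈ {α = α} eqα eqγ′ γ≈γ′ rel = record
  { isEquivalence = eqγ′
  ; isNonCrossing = NonCrossing-resp-≈ γ≈γ′ isNonCrossing
  ; compatible    = compatible-resp-≈ (≈-refl {R = α}) γ≈γ′ compatible
  ; join≈         = ≈-trans (≈-sym (join-congʳ eqα isEquivalence eqγ′ γ≈γ′)) join≈ }
  where open IsRelKreweras rel

isRelKreweras-unique : ∀ {n α β γ γ′} → IsEquivalenceOn n α → IsEquivalenceOn n β → NonCrossing n β →
                       IsRelKreweras n α β γ → IsRelKreweras n α β γ′ → γ ≈[ n ] γ′
isRelKreweras-unique eqα eqβ ncβ rel rel′ = ≈-trans (Uniqueness.≈κ rel) (≈-sym (Uniqueness.≈κ rel′))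
  where open ExplicitKreweras eqα eqβ ncβ

isKrewerasCandidate : ℕ → Part → Part → Part → Bool
isKrewerasCandidate n α β γ = admissible n α γ ∧ eqPart n (circ n α γ) β

kreweras-found : ∀ n α β {γ} → findᵇ (isKrewerasCandidate n α β) (NCP n) ≡ just γ → kreweras n α β ≡ γ
kreweras-found n α β found rewrite found = refl

module _ {n : ℕ} {α β : Part} (eqα : IsEquivalenceOn n α) where

  isRelKreweras⇒candidate : NonCrossing n α → ∀ {γ} → IsRelKreweras n α β γ → T (isKrewerasCandidate n α β γ)
  isRelKreweras⇒candidate ncα rel = Equivalence.from T-∧
    (adm , ≈⇒eqPart (≈-trans (circ≈join eqα isEquivalence adm) join≈))
    where
    open IsRelKreweras rel
    adm = compatible⇒admissible ncα isNonCrossing compatible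

  candidate⇒isRelKreweras : ∀ {γ} → γ ∈ NCP n → T (isKrewerasCandidate n α β γ) → IsRelKreweras n α β γ
  candidate⇒isRelKreweras {γ} γ∈ candidate = record
    { isEquivalence = eqγ
    ; isNonCrossing = ∈NCP⇒nonCrossing {n} γ∈
    ; compatible    = admissible⇒compatible eqα eqγ adm
    ; join≈         = ≈-trans (≈-sym (circ≈join eqα eqγ adm)) (eqPart⇒≈ {n} {circ n α γ} {β} circ≈β) }
    where
    eqγ = ∈NCP⇒isEquivalence {n} γ∈
    adm = proj₁ (Equivalence.to (T-∧ {admissible n α γ}) candidate)
    circ≈β = proj₂ (Equivalence.to (T-∧ {admissible n α γ}) candidate)

kreweras-isRelKreweras : ∀ {n α β} → α ∈ NCP n → β ∈ NCP n → α ⊆[ n ] β →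
                         IsRelKreweras n α β (kreweras n α β)
kreweras-isRelKreweras {n} {α} {β} α∈ β∈ α⊆β =
  let γ , found = findᵇ-complete (isKrewerasCandidate n α β) (representative∈NCP κ-isEquivalence κ-nonCrossing)
                    (isRelKreweras⇒candidate eqα ncα representative-isRelKreweras)
  in subst (IsRelKreweras n α β) (sym (kreweras-found n α β found))
       (candidate⇒isRelKreweras eqα (proj₁ (findᵇ-just _ (NCP n) found)) (proj₂ (findᵇ-just _ (NCP n) found)))
  where
  eqα = ∈NCP⇒isEquivalence {n} α∈
  ncα = ∈NCP⇒nonCrossing {n} α∈
  open ExplicitKreweras eqα (∈NCP⇒isEquivalence {n} β∈) (∈NCP⇒nonCrossing {n} β∈)
  open Existence ncα α⊆β
  open Canonical κ-isEquivalence using (labels; toPart-labels≈)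
  representative-isRelKreweras : IsRelKreweras n α β (toPart labels)
  representative-isRelKreweras =
    isRelKreweras-resp-≈ eqα (toPart-isEquivalence labels) (≈-sym toPart-labels≈) κ-isRelKreweras

-- Factorizations of an interval

isFactorization : ℕ → Part → Part → Part → Part → Part → Bool
isFactorization n α β a b γ =
  refines n α γ ∧ refines n γ β ∧ eqPart n (kreweras n α γ) a ∧ eqPart n (kreweras n γ β) b

record Factorization (n : ℕ) (α β a b γ : Part) : Set where
  field
    α⊆γ         : α ⊆[ n ] γ
    γ⊆β         : γ ⊆[ n ] β
    krewerasˡ≈  : kreweras n α γ ≈[ n ] a
    krewerasʳ≈  : kreweras n γ β ≈[ n ] b

isFactorization⇒Factorization : ∀ {n α β a b γ} → T (isFactorization n α β a b γ) → Factorization n α β a b γ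
isFactorization⇒Factorization {n} {α} {β} {a} {b} {γ} h with Equivalence.to (T-∧ {refines n α γ}) h
... | αγ , h′ with Equivalence.to (T-∧ {refines n γ β}) h′
...   | γβ , h″ with Equivalence.to (T-∧ {eqPart n (kreweras n α γ) a}) h″
...     | ka , kb = record
  { α⊆γ = refines⇒⊆ {n} {α} {γ} αγ ; γ⊆β = refines⇒⊆ {n} {γ} {β} γβ
  ; krewerasˡ≈ = eqPart⇒≈ {n} {kreweras n α γ} {a} ka ; krewerasʳ≈ = eqPart⇒≈ {n} {kreweras n γ β} {b} kb }

Factorization⇒isFactorization : ∀ {n α β a b γ} → Factorization n α β a b γ → T (isFactorization n α β a b γ)
Factorization⇒isFactorization F = Equivalence.from T-∧ (⊆⇒refines α⊆γ , Equivalence.from T-∧ (⊆⇒refines γ⊆β ,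
                     Equivalence.from T-∧ (≈⇒eqPart krewerasˡ≈ , ≈⇒eqPart krewerasʳ≈)))
  where open Factorization F

module Factorizations {n α β} (α∈ : α ∈ NCP n) (β∈ : β ∈ NCP n) (α⊆β : α ⊆[ n ] β) where
  private
    eqα = ∈NCP⇒isEquivalence {n} α∈
    ncα = ∈NCP⇒nonCrossing {n} α∈
    eqβ = ∈NCP⇒isEquivalence {n} β∈
    ncβ = ∈NCP⇒nonCrossing {n} β∈
    κ = kreweras n α β
    relκ = kreweras-isRelKreweras α∈ β∈ α⊆β
    module K = IsRelKreweras relκ

  κ⊆β : κ ⊆[ n ] β
  κ⊆β = ⊆-trans (⊆-joinʳ eqα K.isEquivalence) (≈⇒⊆ K.join≈)

  module _ {a b} (a∈ : a ∈ NCP n) (b∈ : b ∈ NCP n) where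
    private
      eqa = ∈NCP⇒isEquivalence {n} a∈
      nca = ∈NCP⇒nonCrossing {n} a∈
      eqb = ∈NCP⇒isEquivalence {n} b∈
      ncb = ∈NCP⇒nonCrossing {n} b∈

    factorization⇒isRelKreweras : ∀ {γ} → γ ∈ NCP n → Factorization n α β a b γ → IsRelKreweras n a κ b
    factorization⇒isRelKreweras {γ} γ∈ F = record
      { isEquivalence = eqb
      ; isNonCrossing = ncb
      ; compatible    = compatible-resp-≈ krewerasˡ≈ krewerasʳ≈ compatible′
      ; join≈         = ≈-trans (join-cong eqa eqa′ eqb eqb′ (≈-sym krewerasˡ≈) (≈-sym krewerasʳ≈)) join′≈κ }
      where
      open Factorization F
      rel₁ = kreweras-isRelKreweras α∈ γ∈ α⊆γ
      rel₂ = kreweras-isRelKreweras γ∈ β∈ γ⊆β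
      module R₁ = IsRelKreweras rel₁
      module R₂ = IsRelKreweras rel₂
      eqγ = ∈NCP⇒isEquivalence {n} γ∈
      eqa′ = R₁.isEquivalence
      eqb′ = R₂.isEquivalence
      compatible′ : Compatible n (kreweras n α γ) (kreweras n γ β)
      compatible′ = compatible-antitoneˡ (⊆-trans (⊆-joinʳ eqα eqa′) (≈⇒⊆ R₁.join≈)) R₂.compatible
      join′-isRelKreweras : IsRelKreweras n α β (join n (kreweras n α γ) (kreweras n γ β))
      join′-isRelKreweras = record
        { isEquivalence = join-isEquivalence eqa′ eqb′
        ; isNonCrossing = join-nonCrossing eqa′ eqb′
                            (compatible⇒admissible R₁.isNonCrossing R₂.isNonCrossing compatible′)
        ; compatible    = compatible-joinʳ eqa′ eqb′ R₁.compatible (compatible-antitoneˡ α⊆γ R₂.compatible)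
        ; join≈         = ≈-trans (≈-sym (join-assoc eqα eqa′ eqb′))
                            (≈-trans (join-cong (join-isEquivalence eqα eqa′) eqγ eqb′ eqb′
                                                R₁.join≈ (≈-refl {R = kreweras n γ β}))
                              R₂.join≈) }
      join′≈κ = isRelKreweras-unique eqα eqβ ncβ join′-isRelKreweras relκ

    module _ (rel : IsRelKreweras n a κ b) where
      private
        module R = IsRelKreweras rel
        compatible-α-ab : Compatible n α (join n a b)
        compatible-α-ab = compatible-resp-≈ (≈-refl {R = α}) (≈-sym R.join≈) K.compatible
        compatible-α-a = compatible-antitoneʳ (⊆-joinˡ eqa eqb) compatible-α-ab
        compatible-α-b = compatible-antitoneʳ (⊆-joinʳ eqa eqb) compatible-α-ab
        eqαa = join-isEquivalence eqα eqa

      factorization⇒≈ : ∀ {γ} → γ ∈ NCP n → Factorization n α β a b γ → γ ≈[ n ] join n α a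
      factorization⇒≈ γ∈ F = ≈-trans (≈-sym R₁.join≈) (join-congʳ eqα R₁.isEquivalence eqa krewerasˡ≈)
        where
        open Factorization F
        module R₁ = IsRelKreweras (kreweras-isRelKreweras α∈ γ∈ α⊆γ)

      ≈⇒factorization : ∀ {γ} → γ ∈ NCP n → γ ≈[ n ] join n α a → Factorization n α β a b γ
      ≈⇒factorization {γ} γ∈ γ≈αa = record
        { α⊆γ = α⊆γ ; γ⊆β = γ⊆β
        ; krewerasˡ≈ = isRelKreweras-unique eqα eqγ ncγ (kreweras-isRelKreweras α∈ γ∈ α⊆γ) a-isRelKreweras
        ; krewerasʳ≈ = isRelKreweras-unique eqγ eqβ ncβ (kreweras-isRelKreweras γ∈ β∈ γ⊆β) b-isRelKreweras }
        where
        eqγ = ∈NCP⇒isEquivalence {n} γ∈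
        ncγ = ∈NCP⇒nonCrossing {n} γ∈
        α⊆γ = ⊆-trans (⊆-joinˡ eqα eqa) (≈⇒⊇ γ≈αa)
        γ⊆β = ⊆-trans (≈⇒⊆ γ≈αa)
                (join-least eqα eqa eqβ α⊆β (⊆-trans (⊆-joinˡ eqa eqb) (⊆-trans (≈⇒⊆ R.join≈) κ⊆β)))
        a-isRelKreweras : IsRelKreweras n α γ a
        a-isRelKreweras = record
          { isEquivalence = eqa ; isNonCrossing = nca ; compatible = compatible-α-a ; join≈ = ≈-sym γ≈αa }
        b-isRelKreweras : IsRelKreweras n γ β b
        b-isRelKreweras = record
          { isEquivalence = eqb ; isNonCrossing = ncb
          ; compatible    = compatible-resp-≈ (≈-sym γ≈αa) (≈-refl {R = b})
                              (compatible-joinˡ eqα eqa compatible-α-b R.compatible)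
          ; join≈         = ≈-trans (join-cong eqγ eqαa eqb eqb γ≈αa (≈-refl {R = b}))
                              (≈-trans (join-assoc eqα eqa eqb)
                                (≈-trans (join-congʳ eqα (join-isEquivalence eqa eqb) K.isEquivalence R.join≈) K.join≈)) }

      count-factorizations≡1 : count (isFactorization n α β a b) (NCP n) ≡ 1
      count-factorizations≡1 =
        count-NCP≡1 eqαa (join-nonCrossing eqα eqa (compatible⇒admissible ncα nca compatible-α-a))
          (isFactorization n α β a b)
          (λ γ∈ → factorization⇒≈ γ∈ ∘ isFactorization⇒Factorization)
          (λ γ∈ → Factorization⇒isFactorization ∘ ≈⇒factorization γ∈)

  count-factorizations≡0 : ∀ {a b} → a ∈ NCP n → b ∈ NCP n → ¬ T (isKrewerasCandidate n a κ b) →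
                           count (isFactorization n α β a b) (NCP n) ≡ 0
  count-factorizations≡0 a∈ b∈ ¬candidate = count≡0 λ γ∈ F →
    ¬candidate (isRelKreweras⇒candidate (∈NCP⇒isEquivalence {n} a∈) (∈NCP⇒nonCrossing {n} a∈)
                 (factorization⇒isRelKreweras a∈ b∈ γ∈ (isFactorization⇒Factorization F)))

  zeroP-isRelKreweras : α ≈[ n ] β → IsRelKreweras n α β zeroP
  zeroP-isRelKreweras α≈β = record
    { isEquivalence = zeroP-isEquivalence
    ; isNonCrossing = zeroP-nonCrossing
    ; compatible    = λ {y} {w} _ _ y≡w → subst (λ x → Saturated n α (insideγ y x)) (≡ᵇ⇒≡ y w y≡w)
                        (saturated-≗ {R = α} (λ p → sym (insideγ-self y p)) λ _ _ _ → refl)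
    ; join≈         = ≈-trans (join-zeroʳ eqα) α≈β }

  counit : counitCirc n κ ≡ counitInc n α β
  counit = T-ext κ≈zero⇒α≈β λ α≈β →
    ≈⇒eqPart (isRelKreweras-unique eqα eqβ ncβ relκ (zeroP-isRelKreweras (eqPart⇒≈ {n} {α} {β} α≈β)))
    where
    κ≈zero⇒α≈β : T (eqPart n κ zeroP) → T (eqPart n α β)
    κ≈zero⇒α≈β κ≈0 = ≈⇒eqPart (≈-trans (≈-sym (join-zeroʳ eqα))
      (≈-trans (≈-sym (join-congʳ eqα K.isEquivalence zeroP-isEquivalence (eqPart⇒≈ {n} {κ} κ≈0))) K.join≈))

proposition5p5 : (n : ℕ) → 1 ≤ n →
    (α β : Part) → α ∈ NCP n → β ∈ NCP n → refines n α β ≡ true →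
      ((a b : Part) → a ∈ NCP n → b ∈ NCP n →
         coeffLeft n α β a b ≡ coeffRight n α β a b)
      × (counitCirc n (kreweras n α β) ≡ counitInc n α β)
proposition5p5 n _ α β α∈ β∈ α∣β = coefficients , counit
  where
  open Factorizations α∈ β∈ (refines⇒⊆ {n} {α} {β} (Equivalence.from T-≡ α∣β))
  coefficients : (a b : Part) → a ∈ NCP n → b ∈ NCP n → coeffLeft n α β a b ≡ coeffRight n α β a b
  -- coeffRight n α β a b tests exactly isKrewerasCandidate n a (kreweras n α β) b
  coefficients a b a∈ b∈ with T? (isKrewerasCandidate n a (kreweras n α β) b)
  ... | yes candidate rewrite Equivalence.to T-≡ candidate =
    count-factorizations≡1 a∈ b∈ (candidate⇒isRelKreweras (∈NCP⇒isEquivalence {n} a∈) b∈ candidate)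
  ... | no ¬candidate rewrite Equivalence.to T-not-≡ (¬T⇒T-not ¬candidate) =
    count-factorizations≡0 a∈ b∈ ¬candidate
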